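{- Let $K$ be an imaginary quadratic number field with ring of integers $\mathcal O_K$, and assume that the Euclidean minimum $\mu:=\mu(\mathcal O_K)$ satisfies $\mu<1$. Let $L$ be a $2$-dimensional Hermitian $\mathcal O_K$-lattice with $\min(L)=m$. Then $d_L\ge m^2(1-\mu)$.
   Context: The Euclidean minimum is $\mu(\mathcal O_K)=\sup_{x\in K}\inf_{a\in\mathcal O_K}N_{K/\mathbb{Q}}(x-a)$. A Hermitian $\mathcal O_K$-lattice is a finitely generated $\mathcal O_K$-submodule $L$ of a finite-dimensional $K$-vector space $V$ with a positive definite Hermitian form $h$, containing a $K$-basis of $V$; its dimension is $\dim_K V$. Its minimum is $\min(L)=\min\{h(v,v): 0\ne v\in L\}$. Its discriminant $d_L$: writing $L=\mathfrak a_1e_1\oplus\cdots\oplus\mathfrak a_ne_n$ with $(e_i)$ a $K$-basis and $\mathfrak a_i$ fractional ideals, $d_L$ is the positive rational generator of the ideal $\det(h(e_i,e_j))\prod_i\mathfrak a_i\overline{\mathfrak a_i}$; when $L$ is free this is the determinant of the Hermitian Gram matrix of an $\mathcal O_K$-basis. -}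

module Defs where

open import Data.Nat as ℕ using (ℕ; zero; suc)
open import Data.Nat.Divisibility using (_∣_)
open import Data.Integer as ℤ using (ℤ; +_)
open import Data.Rational as ℚ using (ℚ; 0ℚ; 1ℚ; ↧ₙ_)
open import Data.Fin using (Fin; zero; suc; toℕ)
open import Data.Product using (Σ; _×_; _,_; ∃; ∃-syntax; proj₁; proj₂)
open import Data.Sum using (_⊎_)
open import Function.Bundles using (_⇔_)
open import Relation.Binary.PropositionalEquality using (_≡_)
open import Relation.Nullary using (¬_)

-- d is squarefree (and positive); K = ℚ(√-d) is then an arbitrary
-- imaginary quadratic field (up to isomorphism).
SquareFree : ℕ → Set
SquareFree n = ∀ (p : ℕ) → (p ℕ.* p) ∣ n → p ≡ 1

-- elements of K = ℚ(√-d): a pair (a , b) stands for a + b √-d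
K : Set
K = ℚ × ℚ

IsInt : ℚ → Set
IsInt q = ↧ₙ q ≡ 1

module _ (d : ℕ) where

  dℚ : ℚ
  dℚ = (+ d) ℚ./ 1

  0K : K
  0K = 0ℚ , 0ℚ

  1K : K
  1K = 1ℚ , 0ℚ

  ι : ℚ → K
  ι q = q , 0ℚ

  _+K_ : K → K → K
  (a , b) +K (c , e) = (a ℚ.+ c) , (b ℚ.+ e)

  -K_ : K → K
  -K (a , b) = (ℚ.- a) , (ℚ.- b)

  _-K_ : K → K → K
  x -K y = x +K (-K y)

  -- (a + b√-d)(c + e√-d) = (ac - d be) + (ae + bc)√-d
  _*K_ : K → K → K
  (a , b) *K (c , e) = ((a ℚ.* c) ℚ.- (dℚ ℚ.* (b ℚ.* e))) , ((a ℚ.* e) ℚ.+ (b ℚ.* c))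

  conj : K → K
  conj (a , b) = a , (ℚ.- b)

  NK : K → ℚ
  NK (a , b) = (a ℚ.* a) ℚ.+ (dℚ ℚ.* (b ℚ.* b))

  powK : K → ℕ → K
  powK x zero = 1K
  powK x (suc n) = x *K powK x n

  ΣK : (n : ℕ) → (Fin n → K) → K
  ΣK zero f = 0K
  ΣK (suc n) f = f zero +K ΣK n (λ i → f (suc i))

  InOK : K → Set
  InOK x = Σ ℕ λ n → Σ (Fin n → ℤ) λ c → (powK x n +K ΣK n (λ (i : Fin n) → ι ((c i) ℚ./ 1) *K powK x (toℕ i))) ≡ 0K

  V : Set
  V = K × K

  comp : V → Fin 2 → K
  comp (x , y) zero = x
  comp (x , y) (suc zero) = y

  0V : V
  0V = 0K , 0K

  _+V_ : V → V → V
  (x , y) +V (x' , y') = (x +K x') , (y +K y')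

  _·V_ : K → V → V
  a ·V (x , y) = (a *K x) , (a *K y)

  ΣV : (n : ℕ) → (Fin n → V) → V
  ΣV zero f = 0V
  ΣV (suc n) f = f zero +V ΣV n (λ i → f (suc i))

  IsBasis : V → V → Set
  IsBasis (x , y) (x' , y') = ¬ (((x *K y') -K (y *K x')) ≡ 0K)

  -- A Hermitian form is given by its Gram matrix H in the standard basis:
  -- h(v,w) = Σ_{i,j} v_i H_{ij} conj(w_j)
  Gram : Set
  Gram = Fin 2 → Fin 2 → K

  hf : Gram → V → V → K
  hf H v w = ΣK 2 (λ i → ΣK 2 (λ j → (comp v i *K H i j) *K conj (comp w j)))

  IsHermitian : Gram → Set
  IsHermitian H = ∀ i j → H j i ≡ conj (H i j)

  -- h(v,v) is rational for Hermitian h; qf takes its rational part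
  qf : Gram → V → ℚ
  qf H v = proj₁ (hf H v v)

  PosDef : Gram → Set
  PosDef H = ∀ v → ¬ (v ≡ 0V) → 0ℚ ℚ.< qf H v

  -- O_K-lattices: the O_K-span of finitely many vectors g : Fin k → V

  InLat : (k : ℕ) → (Fin k → V) → V → Set
  InLat k g v = Σ (Fin k → K) λ α → ((∀ i → InOK (α i)) × (v ≡ ΣV k (λ i → α i ·V g i)))

  ContainsBasis : (k : ℕ) → (Fin k → V) → Set
  ContainsBasis k g = ∃[ v ] ∃[ w ] (InLat k g v × InLat k g w × IsBasis v w)

  IsMinimum : Gram → (k : ℕ) → (Fin k → V) → ℚ → Set
  IsMinimum H k g m =
    (∃[ v ] (InLat k g v × ¬ (v ≡ 0V) × qf H v ≡ m))
    × (∀ v → InLat k g v → ¬ (v ≡ 0V) → m ℚ.≤ qf H v)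

  -- Fractional ideals: the O_K-span of finitely many elements of K, not all zero

  InIdeal : (j : ℕ) → (Fin j → K) → K → Set
  InIdeal j a x = Σ (Fin j → K) λ β → ((∀ i → InOK (β i)) × (x ≡ ΣK j (λ i → β i *K a i)))

  IsFracIdeal : (j : ℕ) → (Fin j → K) → Set
  IsFracIdeal j a = ∃[ i ] ¬ (a i ≡ 0K)

  -- the ideal  δ · 𝔞₁ · conj(𝔞₁) · 𝔞₂ · conj(𝔞₂)  (generated by products of generators)
  InDiscIdeal : K → (j₁ : ℕ) → (Fin j₁ → K) → (j₂ : ℕ) → (Fin j₂ → K) → K → Set
  InDiscIdeal δ j₁ a₁ j₂ a₂ x =
    Σ (Fin j₁ → Fin j₁ → Fin j₂ → Fin j₂ → K) λ γ → ((∀ i i' l l' → InOK (γ i i' l l'))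
      × (x ≡ ΣK j₁ (λ i → ΣK j₁ (λ i' → ΣK j₂ (λ l → ΣK j₂ (λ l' →
               γ i i' l l' *K (δ *K ((a₁ i *K conj (a₁ i')) *K (a₂ l *K conj (a₂ l'))))))))))

  -- d_L = dL: for a decomposition L = 𝔞₁e₁ ⊕ 𝔞₂e₂ with (e₁,e₂) a K-basis,
  -- dL is the positive rational generator of det(h(eᵢ,eⱼ)) 𝔞₁ conj(𝔞₁) 𝔞₂ conj(𝔞₂)
  IsDiscriminant : Gram → (k : ℕ) → (Fin k → V) → ℚ → Set
  IsDiscriminant H k g dL =
    Σ V λ e₁ → Σ V λ e₂ → Σ ℕ λ j₁ → Σ (Fin j₁ → K) λ a₁ → Σ ℕ λ j₂ → Σ (Fin j₂ → K) λ a₂ →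
      ( IsBasis e₁ e₂
      × IsFracIdeal j₁ a₁ × IsFracIdeal j₂ a₂
      × (∀ v → InLat k g v ⇔ (Σ K λ x → Σ K λ y → (InIdeal j₁ a₁ x × InIdeal j₂ a₂ y
                                             × v ≡ ((x ·V e₁) +V (y ·V e₂)))))
      × 0ℚ ℚ.< dL
      × (∀ z → InDiscIdeal (((hf H e₁ e₁) *K (hf H e₂ e₂)) -K ((hf H e₁ e₂) *K (hf H e₂ e₁)))
                           j₁ a₁ j₂ a₂ z
               ⇔ (Σ K λ γ → (InOK γ × z ≡ (ι dL *K γ)))))

{-# OPTIONS --safe #-}

-- By hypothesis every x ∈ K has some a ∈ 𝒪_K with N(x − a) ≤ c < 1. Write L = 𝔞₁e₁ ⊕ 𝔞₂e₂ and let
-- v = x₀e₁ + y₀e₂ be a minimal vector, h(v,v) = m. For w = xe₁ + ye₂ in L with λ = x₀y − y₀x ≠ 0,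
-- approximate h(w,v)/m by such an a: the vector w − av lies in L and is nonzero, so m ≤ h(w − av, w − av),
-- and completing the square turns this into Δ = m h(w,w) − |h(w,v)|² ≥ m²(1 − c). A descent on N(λ),
-- driven by the same approximation, finds such a w with x₀𝔞₂ + y₀𝔞₁ ⊆ λ𝒪_K; minimality of v then forces
-- 𝔞₁𝔞₂ ⊆ λ𝒪_K. Since Δ = det(h(eᵢ,eⱼ)) N(λ), the discriminant ideal det(h(eᵢ,eⱼ)) 𝔞₁𝔞̄₁𝔞₂𝔞̄₂ lies in
-- Δ𝒪_K, so the positive rational d_L is an integral multiple of Δ, and d_L ≥ Δ ≥ m²(1 − c).
-- Integrality is handled through trace and norm: an element of K is integral iff all its powers have
-- a common denominator iff its trace and norm are integers.

module Submission where

open import Defs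
open import Algebra.Bundles using (CommutativeRing)
import Algebra.Solver.Ring as RingSolver
open import Algebra.Solver.Ring.AlmostCommutativeRing using (fromCommutativeRing; _-Raw-AlmostCommutative⟶_)
open import Algebra.Structures using (IsCommutativeRing)
open import Data.Empty using (⊥-elim)
open import Data.Fin as Fin using (Fin; zero; suc; toℕ)
import Data.Fin.Properties as FinP
open import Data.Integer as ℤ using (ℤ; +_)
import Data.Integer.GCD as ℤGCD
import Data.Integer.Properties as ℤP
import Data.Integer.Tactic.RingSolver as ℤSolver
import Data.Maybe as Maybe
open import Data.Nat as ℕ using (ℕ; zero; suc)
import Data.Nat.Coprimality as Coprime
import Data.Nat.Divisibility as ℕDiv
open import Data.Nat.Induction using (<-rec; <-wellFounded)
import Data.Nat.Properties as ℕP
open import Data.Product using (Σ; _×_; _,_; proj₁; proj₂; ∃-syntax)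
open import Data.Rational as ℚ using (ℚ; 0ℚ; 1ℚ)
import Data.Rational.Properties as ℚP
import Data.Rational.Unnormalised as ℚᵘ
import Data.Rational.Unnormalised.Properties as ℚᵘP
open import Data.Sum as Sum using (_⊎_; inj₁; inj₂)
open import Function using (_∘_; id)
open import Function.Bundles using (Equivalence; _⇔_)
open import Induction.WellFounded using (module All)
open import Level using (0ℓ)
import Relation.Binary.Construct.On as On
open import Relation.Binary.PropositionalEquality
open import Relation.Nullary using (yes; no; ¬_; Dec)
open import Relation.Nullary.Decidable using (dec⇒maybe; decidable-stable; toSum)
open import Tactic.RingSolver using (solve-∀)
import Tactic.RingSolver.Core.AlmostCommutativeRing as ACR

ℚ-ring : ACR.AlmostCommutativeRing 0ℓ 0ℓ
ℚ-ring = ACR.fromCommutativeRing ℚP.+-*-commutativeRing (dec⇒maybe ∘ (0ℚ ℚP.≟_))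

fromℤ : ℤ → ℚ
fromℤ m = m ℚ./ 1

toℚᵘ-fromℤ : ∀ m → ℚ.toℚᵘ (fromℤ m) ℚᵘ.≃ ℚᵘ.mkℚᵘ m 0
toℚᵘ-fromℤ m = ℚP.toℚᵘ-fromℚᵘ (ℚᵘ.mkℚᵘ m 0)

fromℤ-homo-+ : ∀ m n → fromℤ (m ℤ.+ n) ≡ fromℤ m ℚ.+ fromℤ n
fromℤ-homo-+ m n = ℚP.toℚᵘ-injective (begin-equality
  ℚ.toℚᵘ (fromℤ (m ℤ.+ n))                     ≃⟨ toℚᵘ-fromℤ (m ℤ.+ n) ⟩
  ℚᵘ.mkℚᵘ (m ℤ.+ n) 0                         ≃⟨ ℚᵘ.*≡* (eq m n) ⟩
  ℚᵘ.mkℚᵘ m 0 ℚᵘ.+ ℚᵘ.mkℚᵘ n 0                ≃⟨ ℚᵘP.+-cong (toℚᵘ-fromℤ m) (toℚᵘ-fromℤ n) ⟨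
  ℚ.toℚᵘ (fromℤ m) ℚᵘ.+ ℚ.toℚᵘ (fromℤ n)      ≃⟨ ℚP.toℚᵘ-homo-+ (fromℤ m) (fromℤ n) ⟨
  ℚ.toℚᵘ (fromℤ m ℚ.+ fromℤ n)                ∎)
  where
  open ℚᵘP.≤-Reasoning
  eq : ∀ m n → (m ℤ.+ n) ℤ.* + 1 ≡ (m ℤ.* + 1 ℤ.+ n ℤ.* + 1) ℤ.* + 1
  eq = ℤSolver.solve-∀

fromℤ-homo-* : ∀ m n → fromℤ (m ℤ.* n) ≡ fromℤ m ℚ.* fromℤ n
fromℤ-homo-* m n = ℚP.toℚᵘ-injective (begin-equality
  ℚ.toℚᵘ (fromℤ (m ℤ.* n))                     ≃⟨ toℚᵘ-fromℤ (m ℤ.* n) ⟩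
  ℚᵘ.mkℚᵘ (m ℤ.* n) 0                         ≃⟨ ℚᵘ.*≡* refl ⟩
  ℚᵘ.mkℚᵘ m 0 ℚᵘ.* ℚᵘ.mkℚᵘ n 0                ≃⟨ ℚᵘP.*-cong (toℚᵘ-fromℤ m) (toℚᵘ-fromℤ n) ⟨
  ℚ.toℚᵘ (fromℤ m) ℚᵘ.* ℚ.toℚᵘ (fromℤ n)      ≃⟨ ℚP.toℚᵘ-homo-* (fromℤ m) (fromℤ n) ⟨
  ℚ.toℚᵘ (fromℤ m ℚ.* fromℤ n)                ∎)
  where open ℚᵘP.≤-Reasoning

fromℤ-+-* : ∀ m n → fromℤ (+ (m ℕ.* n)) ≡ fromℤ (+ m) ℚ.* fromℤ (+ n)
fromℤ-+-* m n = trans (cong fromℤ (ℤP.pos-* m n)) (fromℤ-homo-* (+ m) (+ n))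

fromℤ-homo‿- : ∀ m → fromℤ (ℤ.- m) ≡ ℚ.- fromℤ m
fromℤ-homo‿- m = ℚP.toℚᵘ-injective (ℚᵘP.≃-trans (toℚᵘ-fromℤ (ℤ.- m))
  (ℚᵘP.≃-sym (ℚᵘP.≃-trans (ℚP.toℚᵘ-homo‿- (fromℤ m)) (ℚᵘP.-‿cong (toℚᵘ-fromℤ m)))))

fromℤ-injective : ∀ {m n} → fromℤ m ≡ fromℤ n → m ≡ n
fromℤ-injective {m} {n} eq
  with ℚᵘP.≃-trans (ℚᵘP.≃-sym (toℚᵘ-fromℤ m)) (ℚᵘP.≃-trans (ℚP.toℚᵘ-cong eq) (toℚᵘ-fromℤ n))
... | ℚᵘ.*≡* p = trans (sym (ℤP.*-identityʳ m)) (trans p (ℤP.*-identityʳ n))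

fromℤ-mono-≤ : ∀ {m n} → m ℤ.≤ n → fromℤ m ℚ.≤ fromℤ n
fromℤ-mono-≤ {m} {n} m≤n = ℚP.toℚᵘ-cancel-≤
  (ℚᵘP.≤-respˡ-≃ (ℚᵘP.≃-sym (toℚᵘ-fromℤ m)) (ℚᵘP.≤-respʳ-≃ (ℚᵘP.≃-sym (toℚᵘ-fromℤ n))
    (ℚᵘ.*≤* (subst₂ ℤ._≤_ (sym (ℤP.*-identityʳ m)) (sym (ℤP.*-identityʳ n)) m≤n))))

fromℤ-cancel-≤ : ∀ {m n} → fromℤ m ℚ.≤ fromℤ n → m ℤ.≤ n
fromℤ-cancel-≤ {m} {n} le
  with ℚᵘP.≤-respˡ-≃ (toℚᵘ-fromℤ m) (ℚᵘP.≤-respʳ-≃ (toℚᵘ-fromℤ n) (ℚP.toℚᵘ-mono-≤ le))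
... | ℚᵘ.*≤* p = subst₂ ℤ._≤_ (ℤP.*-identityʳ m) (ℤP.*-identityʳ n) p

fromℤ-cancel-< : ∀ {m n} → fromℤ m ℚ.< fromℤ n → m ℤ.< n
fromℤ-cancel-< {m} {n} lt
  with ℚᵘP.<-respˡ-≃ (toℚᵘ-fromℤ m) (ℚᵘP.<-respʳ-≃ (toℚᵘ-fromℤ n) (ℚP.toℚᵘ-mono-< lt))
... | ℚᵘ.*<* p = subst₂ ℤ._<_ (ℤP.*-identityʳ m) (ℤP.*-identityʳ n) p

IsInteger : ℚ → Set
IsInteger q = Σ ℤ λ z → q ≡ fromℤ z

integer-+ : ∀ {p q} → IsInteger p → IsInteger q → IsInteger (p ℚ.+ q)
integer-+ (m , refl) (n , refl) = m ℤ.+ n , sym (fromℤ-homo-+ m n)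

integer-* : ∀ {p q} → IsInteger p → IsInteger q → IsInteger (p ℚ.* q)
integer-* (m , refl) (n , refl) = m ℤ.* n , sym (fromℤ-homo-* m n)

integer-neg : ∀ {p} → IsInteger p → IsInteger (ℚ.- p)
integer-neg (m , refl) = ℤ.- m , sym (fromℤ-homo‿- m)

↧p*p≡↥p : ∀ p → fromℤ (+ ℚ.↧ₙ p) ℚ.* p ≡ fromℤ (ℚ.↥ p)
↧p*p≡↥p p@(ℚ.mkℚ n q-1 _) = ℚP.toℚᵘ-injective (begin-equality
  ℚ.toℚᵘ (fromℤ (+ q) ℚ.* p)              ≃⟨ ℚP.toℚᵘ-homo-* (fromℤ (+ q)) p ⟩
  ℚ.toℚᵘ (fromℤ (+ q)) ℚᵘ.* ℚᵘ.mkℚᵘ n q-1 ≃⟨ ℚᵘP.*-cong (toℚᵘ-fromℤ (+ q)) (ℚᵘP.≃-refl {ℚᵘ.mkℚᵘ n q-1}) ⟩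
  ℚᵘ.mkℚᵘ (+ q) 0 ℚᵘ.* ℚᵘ.mkℚᵘ n q-1       ≃⟨ ℚᵘ.*≡* eq ⟩
  ℚᵘ.mkℚᵘ n 0                             ≃⟨ toℚᵘ-fromℤ n ⟨
  ℚ.toℚᵘ (fromℤ n)                        ∎)
  where
  open ℚᵘP.≤-Reasoning
  q = suc q-1
  eq : (+ q ℤ.* n) ℤ.* + 1 ≡ n ℤ.* + (1 ℕ.* q)
  eq = trans (ℤP.*-identityʳ _) (trans (ℤP.*-comm (+ q) n) (cong (λ k → n ℤ.* + k) (sym (ℕP.*-identityˡ q))))

denominator≡1⇒integer : ∀ r → ℚ.↧ₙ r ≡ 1 → IsInteger r
denominator≡1⇒integer r ↧r≡1 = ℚ.↥ r , trans (sym (ℚP.*-identityˡ r))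
  (trans (cong (λ n → fromℤ (+ n) ℚ.* r) (sym ↧r≡1)) (↧p*p≡↥p r))

integer⇒denominator≡1 : ∀ r → IsInteger r → ℚ.↧ₙ r ≡ 1
integer⇒denominator≡1 _ (z , refl) = ℕP.m*n≡1⇒m≡1 _ _
  (trans (sym (ℤP.abs-* (ℚ.↧ (fromℤ z)) (ℤGCD.gcd z (+ 1)))) (cong ℤ.∣_∣ (ℚP.↧-/ z 1)))

0≤integer⇒ℕ : ∀ {q} → 0ℚ ℚ.≤ q → IsInteger q → Σ ℕ λ n → q ≡ fromℤ (+ n)
0≤integer⇒ℕ 0≤q (+ n , q≡n) = n , q≡n
0≤integer⇒ℕ 0≤q (ℤ.-[1+ n ] , refl) with fromℤ-cancel-≤ {+ 0} {ℤ.-[1+ n ]} 0≤q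
... | ()

integer? : ∀ r → Dec (IsInteger r)
integer? r with ℚ.↧ₙ r ℕ.≟ 1
... | yes ↧r≡1 = yes (denominator≡1⇒integer r ↧r≡1)
... | no ↧r≢1 = no (λ int → ↧r≢1 (integer⇒denominator≡1 r int))

infixr 8 _^ℚ_

_^ℚ_ : ℚ → ℕ → ℚ
r ^ℚ zero = 1ℚ
r ^ℚ suc k = r ℚ.* r ^ℚ k

↧p^k*p^k≡↥p^k : ∀ p k → fromℤ (+ (ℚ.↧ₙ p ℕ.^ k)) ℚ.* p ^ℚ k ≡ fromℤ (ℚ.↥ p ℤ.^ k)
↧p^k*p^k≡↥p^k p zero = refl
↧p^k*p^k≡↥p^k p (suc k) = begin
  fromℤ (+ (q ℕ.* q ℕ.^ k)) ℚ.* (p ℚ.* p ^ℚ k)           ≡⟨ cong (ℚ._* (p ℚ.* p ^ℚ k)) (fromℤ-+-* q (q ℕ.^ k)) ⟩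
  (fromℤ (+ q) ℚ.* fromℤ (+ (q ℕ.^ k))) ℚ.* (p ℚ.* p ^ℚ k) ≡⟨ interchange (fromℤ (+ q)) (fromℤ (+ (q ℕ.^ k))) p (p ^ℚ k) ⟩
  (fromℤ (+ q) ℚ.* p) ℚ.* (fromℤ (+ (q ℕ.^ k)) ℚ.* p ^ℚ k) ≡⟨ cong₂ ℚ._*_ (↧p*p≡↥p p) (↧p^k*p^k≡↥p^k p k) ⟩
  fromℤ (ℚ.↥ p) ℚ.* fromℤ (ℚ.↥ p ℤ.^ k)                  ≡⟨ fromℤ-homo-* (ℚ.↥ p) (ℚ.↥ p ℤ.^ k) ⟨
  fromℤ (ℚ.↥ p ℤ.^ suc k)                                ∎
  where
  open ≡-Reasoning
  q = ℚ.↧ₙ p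
  interchange : ∀ a b c e → (a ℚ.* b) ℚ.* (c ℚ.* e) ≡ (a ℚ.* c) ℚ.* (b ℚ.* e)
  interchange = solve-∀ ℚ-ring

∣i^n∣≡∣i∣^n : ∀ i n → ℤ.∣ i ℤ.^ n ∣ ≡ ℤ.∣ i ∣ ℕ.^ n
∣i^n∣≡∣i∣^n i zero = refl
∣i^n∣≡∣i∣^n i (suc n) = trans (ℤP.abs-* i (i ℤ.^ n)) (cong (ℤ.∣ i ∣ ℕ.*_) (∣i^n∣≡∣i∣^n i n))

coprime-*ʳ : ∀ {m n o} → Coprime.Coprime m n → Coprime.Coprime m o → Coprime.Coprime m (n ℕ.* o)
coprime-*ʳ {m} {n} m⊥n m⊥o {i} (i∣m , i∣no) = m⊥o (i∣m , Coprime.coprime-divisor i⊥n i∣no)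
  where
  i⊥n : Coprime.Coprime i n
  i⊥n (j∣i , j∣n) = m⊥n (ℕDiv.∣-trans j∣i i∣m , j∣n)

coprime-^ʳ : ∀ {m n} k → Coprime.Coprime m n → Coprime.Coprime m (n ℕ.^ k)
coprime-^ʳ zero _ (_ , i∣1) = ℕDiv.∣1⇒≡1 i∣1
coprime-^ʳ (suc k) m⊥n = coprime-*ʳ m⊥n (coprime-^ʳ k m⊥n)

coprime-^ : ∀ {m n} k → Coprime.Coprime m n → Coprime.Coprime (m ℕ.^ k) (n ℕ.^ k)
coprime-^ k m⊥n = Coprime.sym (coprime-^ʳ k (Coprime.sym (coprime-^ʳ k m⊥n)))

n<2^n : ∀ n → n ℕ.< 2 ℕ.^ n
n<2^n zero = ℕ.s≤s ℕ.z≤n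
n<2^n (suc n) = ℕP.+-mono-≤-< (ℕP.m^n>0 2 n) (subst (n ℕ.<_) (sym (ℕP.+-identityʳ (2 ℕ.^ n))) (n<2^n n))

-- If the denominator q of r were at least 2, then q^D would divide D, as it is coprime to the numerator,
-- contradicting D < 2^D ≤ q^D.
bounded-powers⇒integer : ∀ D → 1 ℕ.≤ D → ∀ r → (∀ k → IsInteger (fromℤ (+ D) ℚ.* r ^ℚ k)) → IsInteger r
bounded-powers⇒integer D 1≤D r@(ℚ.mkℚ _ zero _) _ = denominator≡1⇒integer r refl
bounded-powers⇒integer D 1≤D r@(ℚ.mkℚ p (suc q-2) p⊥q) bounded = ⊥-elim (ℕP.<-irrefl refl (ℕP.<-≤-trans (n<2^n D)
    (ℕP.≤-trans (ℕP.^-monoˡ-≤ D (ℕ.s≤s (ℕ.s≤s ℕ.z≤n))) (ℕDiv.∣⇒≤ {{ℕ.>-nonZero 1≤D}} q^D∣D))))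
  where
  q = suc (suc q-2)
  z = proj₁ (bounded D)
  D*p^D≡z*q^D : + D ℤ.* p ℤ.^ D ≡ z ℤ.* + (q ℕ.^ D)
  D*p^D≡z*q^D = fromℤ-injective (begin
    fromℤ (+ D ℤ.* p ℤ.^ D)                              ≡⟨ fromℤ-homo-* (+ D) (p ℤ.^ D) ⟩
    fromℤ (+ D) ℚ.* fromℤ (p ℤ.^ D)                      ≡⟨ cong (fromℤ (+ D) ℚ.*_) (↧p^k*p^k≡↥p^k r D) ⟨
    fromℤ (+ D) ℚ.* (fromℤ (+ (q ℕ.^ D)) ℚ.* r ^ℚ D)     ≡⟨ rearrange (fromℤ (+ D)) (fromℤ (+ (q ℕ.^ D))) (r ^ℚ D) ⟩
    (fromℤ (+ D) ℚ.* r ^ℚ D) ℚ.* fromℤ (+ (q ℕ.^ D))     ≡⟨ cong (ℚ._* fromℤ (+ (q ℕ.^ D))) (proj₂ (bounded D)) ⟩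
    fromℤ z ℚ.* fromℤ (+ (q ℕ.^ D))                      ≡⟨ fromℤ-homo-* z (+ (q ℕ.^ D)) ⟨
    fromℤ (z ℤ.* + (q ℕ.^ D))                            ∎)
    where
    open ≡-Reasoning
    rearrange : ∀ a b c → a ℚ.* (b ℚ.* c) ≡ (a ℚ.* c) ℚ.* b
    rearrange = solve-∀ ℚ-ring
  ∣p∣^D*D≡∣z∣*q^D : ℤ.∣ p ∣ ℕ.^ D ℕ.* D ≡ ℤ.∣ z ∣ ℕ.* q ℕ.^ D
  ∣p∣^D*D≡∣z∣*q^D = begin
    ℤ.∣ p ∣ ℕ.^ D ℕ.* D      ≡⟨ ℕP.*-comm (ℤ.∣ p ∣ ℕ.^ D) D ⟩
    D ℕ.* ℤ.∣ p ∣ ℕ.^ D      ≡⟨ cong (D ℕ.*_) (∣i^n∣≡∣i∣^n p D) ⟨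
    D ℕ.* ℤ.∣ p ℤ.^ D ∣      ≡⟨ ℤP.abs-* (+ D) (p ℤ.^ D) ⟨
    ℤ.∣ + D ℤ.* p ℤ.^ D ∣    ≡⟨ cong ℤ.∣_∣ D*p^D≡z*q^D ⟩
    ℤ.∣ z ℤ.* + (q ℕ.^ D) ∣  ≡⟨ ℤP.abs-* z (+ (q ℕ.^ D)) ⟩
    ℤ.∣ z ∣ ℕ.* q ℕ.^ D      ∎
    where open ≡-Reasoning
  q^D∣D : q ℕ.^ D ℕDiv.∣ D
  q^D∣D = Coprime.coprime-divisor (coprime-^ D (Coprime.sym (Coprime.recompute p⊥q))) (ℕDiv.divides ℤ.∣ z ∣ ∣p∣^D*D≡∣z∣*q^D)

0≤p*q : ∀ {p q} → 0ℚ ℚ.≤ p → 0ℚ ℚ.≤ q → 0ℚ ℚ.≤ p ℚ.* q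
0≤p*q {p} {q} 0≤p 0≤q =
  ℚP.nonNegative⁻¹ _ {{ℚP.nonNeg*nonNeg⇒nonNeg p {{ℚ.nonNegative 0≤p}} q {{ℚ.nonNegative 0≤q}}}}

0<p*q : ∀ {p q} → 0ℚ ℚ.< p → 0ℚ ℚ.< q → 0ℚ ℚ.< p ℚ.* q
0<p*q {p} {q} 0<p 0<q =
  ℚP.positive⁻¹ _ {{ℚP.pos*pos⇒pos p {{ℚ.positive 0<p}} q {{ℚ.positive 0<q}}}}

0≤p*p : ∀ p → 0ℚ ℚ.≤ p ℚ.* p
0≤p*p p with ℚP.≤-total 0ℚ p
... | inj₁ 0≤p = 0≤p*q 0≤p 0≤p
... | inj₂ p≤0 = ℚP.nonNegative⁻¹ _ {{ℚP.nonPos*nonPos⇒nonPos p {{ℚ.nonPositive p≤0}} p {{ℚ.nonPositive p≤0}}}}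

p*q≡0⇒p≡0∨q≡0 : ∀ p q → p ℚ.* q ≡ 0ℚ → p ≡ 0ℚ ⊎ q ≡ 0ℚ
p*q≡0⇒p≡0∨q≡0 p q pq≡0 with p ℚP.≟ 0ℚ
... | yes p≡0 = inj₁ p≡0
... | no p≢0 = inj₂ (begin
  q                    ≡⟨ ℚP.*-identityˡ q ⟨
  1ℚ ℚ.* q             ≡⟨ cong (ℚ._* q) (ℚP.*-inverseˡ p {{ℚ.≢-nonZero p≢0}}) ⟨
  (p⁻¹ ℚ.* p) ℚ.* q    ≡⟨ ℚP.*-assoc p⁻¹ p q ⟩
  p⁻¹ ℚ.* (p ℚ.* q)    ≡⟨ cong (p⁻¹ ℚ.*_) pq≡0 ⟩
  p⁻¹ ℚ.* 0ℚ           ≡⟨ ℚP.*-zeroʳ p⁻¹ ⟩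
  0ℚ                   ∎)
  where
  open ≡-Reasoning
  p⁻¹ = (ℚ.1/ p) {{ℚ.≢-nonZero p≢0}}

p*p≡0⇒p≡0 : ∀ p → p ℚ.* p ≡ 0ℚ → p ≡ 0ℚ
p*p≡0⇒p≡0 p pp≡0 with p*q≡0⇒p≡0∨q≡0 p p pp≡0
... | inj₁ p≡0 = p≡0
... | inj₂ p≡0 = p≡0

p+q≡0⇒p≡0 : ∀ {p q} → 0ℚ ℚ.≤ p → 0ℚ ℚ.≤ q → p ℚ.+ q ≡ 0ℚ → p ≡ 0ℚ
p+q≡0⇒p≡0 {p} {q} 0≤p 0≤q p+q≡0 = ℚP.≤-antisym
  (subst (p ℚ.≤_) p+q≡0 (subst (ℚ._≤ p ℚ.+ q) (ℚP.+-identityʳ p) (ℚP.+-monoʳ-≤ p 0≤q))) 0≤p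

p*q<p : ∀ {p q} → 0ℚ ℚ.< p → q ℚ.< 1ℚ → p ℚ.* q ℚ.< p
p*q<p {p} 0<p q<1 = subst (p ℚ.* _ ℚ.<_) (ℚP.*-identityʳ p) (ℚP.*-monoʳ-<-pos p {{ℚ.positive 0<p}} q<1)

p≤q+r∧r≤p*s⇒p*[1-s]≤q : ∀ {p q r} s → p ℚ.≤ q ℚ.+ r → r ℚ.≤ p ℚ.* s → p ℚ.* (1ℚ ℚ.- s) ℚ.≤ q
p≤q+r∧r≤p*s⇒p*[1-s]≤q {p} {q} {r} s p≤q+r r≤ps = begin
  p ℚ.* (1ℚ ℚ.- s)                  ≡⟨ left p s ⟩
  p ℚ.- p ℚ.* s                     ≤⟨ ℚP.+-monoˡ-≤ (ℚ.- (p ℚ.* s)) (ℚP.≤-trans p≤q+r (ℚP.+-monoʳ-≤ q r≤ps)) ⟩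
  q ℚ.+ p ℚ.* s ℚ.- p ℚ.* s         ≡⟨ right q (p ℚ.* s) ⟩
  q                                 ∎
  where
  open ℚP.≤-Reasoning
  left : ∀ p s → p ℚ.* (1ℚ ℚ.- s) ≡ p ℚ.- p ℚ.* s
  left = solve-∀ ℚ-ring
  right : ∀ q t → q ℚ.+ t ℚ.- t ≡ q
  right = solve-∀ ℚ-ring

0<p∧p*p-integer⇒1≤p : ∀ p → 0ℚ ℚ.< p → IsInteger (p ℚ.* p) → 1ℚ ℚ.≤ p
0<p∧p*p-integer⇒1≤p p 0<p (z , pp≡z) with 1ℚ ℚP.≤? p
... | yes 1≤p = 1≤p
... | no 1≰p = ⊥-elim (ℚP.<-irrefl refl (ℚP.<-≤-trans pp<1 (subst (1ℚ ℚ.≤_) (sym pp≡z) (fromℤ-mono-≤ {+ 1} {z} 1≤z))))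
  where
  p<1 = ℚP.≰⇒> 1≰p
  pp<1 : p ℚ.* p ℚ.< 1ℚ
  pp<1 = ℚP.<-trans (p*q<p 0<p p<1) p<1
  1≤z : + 1 ℤ.≤ z
  1≤z with fromℤ-cancel-< {+ 0} {z} (subst (0ℚ ℚ.<_) pp≡z (0<p*q 0<p 0<p))
  ... | ℤ.+<+ 0<n = ℤ.+≤+ 0<n

0≤p∧p≢0⇒0<p : ∀ {p} → 0ℚ ℚ.≤ p → p ≢ 0ℚ → 0ℚ ℚ.< p
0≤p∧p≢0⇒0<p {p} 0≤p p≢0 with p ℚP.≤? 0ℚ
... | yes p≤0 = ⊥-elim (p≢0 (ℚP.≤-antisym p≤0 0≤p))
... | no p≰0 = ℚP.≰⇒> p≰0

module QuadraticField (d : ℕ) where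

  infixl 6 _+_ _-_
  infixl 7 _*_
  infix 8 -_

  _+_ _*_ _-_ : K → K → K
  _+_ = _+K_ d
  _*_ = _*K_ d
  _-_ = _-K_ d

  -_ : K → K
  -_ = -K_ d

  0# 1# : K
  0# = 0K d
  1# = 1K d

  δ : ℚ
  δ = dℚ d

  +-assoc : ∀ x y z → (x + y) + z ≡ x + (y + z)
  +-assoc (a , b) (c , e) (f , g) = cong₂ _,_ (ℚP.+-assoc a c f) (ℚP.+-assoc b e g)

  +-comm : ∀ x y → x + y ≡ y + x
  +-comm (a , b) (c , e) = cong₂ _,_ (ℚP.+-comm a c) (ℚP.+-comm b e)

  +-identityˡ : ∀ x → 0# + x ≡ x
  +-identityˡ (a , b) = cong₂ _,_ (ℚP.+-identityˡ a) (ℚP.+-identityˡ b)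

  +-identityʳ : ∀ x → x + 0# ≡ x
  +-identityʳ (a , b) = cong₂ _,_ (ℚP.+-identityʳ a) (ℚP.+-identityʳ b)

  -‿inverseˡ : ∀ x → - x + x ≡ 0#
  -‿inverseˡ (a , b) = cong₂ _,_ (ℚP.+-inverseˡ a) (ℚP.+-inverseˡ b)

  -‿inverseʳ : ∀ x → x + - x ≡ 0#
  -‿inverseʳ (a , b) = cong₂ _,_ (ℚP.+-inverseʳ a) (ℚP.+-inverseʳ b)

  *-comm : ∀ x y → x * y ≡ y * x
  *-comm (a , b) (c , e) = cong₂ _,_ (re δ a b c e) (im a b c e)
    where
    re : ∀ D a b c e → a ℚ.* c ℚ.- D ℚ.* (b ℚ.* e) ≡ c ℚ.* a ℚ.- D ℚ.* (e ℚ.* b)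
    re = solve-∀ ℚ-ring
    im : ∀ a b c e → a ℚ.* e ℚ.+ b ℚ.* c ≡ c ℚ.* b ℚ.+ e ℚ.* a
    im = solve-∀ ℚ-ring

  *-assoc : ∀ x y z → (x * y) * z ≡ x * (y * z)
  *-assoc (a , b) (c , e) (f , g) = cong₂ _,_ (re δ a b c e f g) (im δ a b c e f g)
    where
    re : ∀ D a b c e f g → (a ℚ.* c ℚ.- D ℚ.* (b ℚ.* e)) ℚ.* f ℚ.- D ℚ.* ((a ℚ.* e ℚ.+ b ℚ.* c) ℚ.* g)
                           ≡ a ℚ.* (c ℚ.* f ℚ.- D ℚ.* (e ℚ.* g)) ℚ.- D ℚ.* (b ℚ.* (c ℚ.* g ℚ.+ e ℚ.* f))
    re = solve-∀ ℚ-ring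
    im : ∀ D a b c e f g → (a ℚ.* c ℚ.- D ℚ.* (b ℚ.* e)) ℚ.* g ℚ.+ (a ℚ.* e ℚ.+ b ℚ.* c) ℚ.* f
                           ≡ a ℚ.* (c ℚ.* g ℚ.+ e ℚ.* f) ℚ.+ b ℚ.* (c ℚ.* f ℚ.- D ℚ.* (e ℚ.* g))
    im = solve-∀ ℚ-ring

  *-identityˡ : ∀ x → 1# * x ≡ x
  *-identityˡ (a , b) = cong₂ _,_ (re δ a b) (im a b)
    where
    re : ∀ D a b → 1ℚ ℚ.* a ℚ.- D ℚ.* (0ℚ ℚ.* b) ≡ a
    re = solve-∀ ℚ-ring
    im : ∀ a b → 1ℚ ℚ.* b ℚ.+ 0ℚ ℚ.* a ≡ b
    im = solve-∀ ℚ-ring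

  *-identityʳ : ∀ x → x * 1# ≡ x
  *-identityʳ x = trans (*-comm x 1#) (*-identityˡ x)

  *-distribˡ-+ : ∀ x y z → x * (y + z) ≡ x * y + x * z
  *-distribˡ-+ (a , b) (c , e) (f , g) = cong₂ _,_ (re δ a b c e f g) (im a b c e f g)
    where
    re : ∀ D a b c e f g → a ℚ.* (c ℚ.+ f) ℚ.- D ℚ.* (b ℚ.* (e ℚ.+ g)) ≡ (a ℚ.* c ℚ.- D ℚ.* (b ℚ.* e)) ℚ.+ (a ℚ.* f ℚ.- D ℚ.* (b ℚ.* g))
    re = solve-∀ ℚ-ring
    im : ∀ a b c e f g → a ℚ.* (e ℚ.+ g) ℚ.+ b ℚ.* (c ℚ.+ f) ≡ (a ℚ.* e ℚ.+ b ℚ.* c) ℚ.+ (a ℚ.* g ℚ.+ b ℚ.* f)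
    im = solve-∀ ℚ-ring

  *-distribʳ-+ : ∀ x y z → (y + z) * x ≡ y * x + z * x
  *-distribʳ-+ x y z = trans (*-comm (y + z) x) (trans (*-distribˡ-+ x y z) (cong₂ _+_ (*-comm x y) (*-comm x z)))

  isCommutativeRing : IsCommutativeRing _≡_ _+_ _*_ -_ 0# 1#
  isCommutativeRing = record
    { isRing = record
      { +-isAbelianGroup = record
        { isGroup = record
          { isMonoid = record
            { isSemigroup = record
              { isMagma = record { isEquivalence = isEquivalence ; ∙-cong = cong₂ _+_ }
              ; assoc = +-assoc }
            ; identity = +-identityˡ , +-identityʳ }
          ; inverse = -‿inverseˡ , -‿inverseʳ
          ; ⁻¹-cong = cong (-K_ d) }
        ; comm = +-comm }
      ; *-cong = cong₂ _*_
      ; *-assoc = *-assoc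
      ; *-identity = *-identityˡ , *-identityʳ
      ; distrib = *-distribˡ-+ , *-distribʳ-+ }
    ; *-comm = *-comm }

  commutativeRing : CommutativeRing 0ℓ 0ℓ
  commutativeRing = record { isCommutativeRing = isCommutativeRing }

  open CommutativeRing commutativeRing public using (zeroˡ; zeroʳ)

  infix 4 _≟_

  _≟_ : (x y : K) → Dec (x ≡ y)
  (a , b) ≟ (c , e) with a ℚP.≟ c | b ℚP.≟ e
  ... | yes a≡c | yes b≡e = yes (cong₂ _,_ a≡c b≡e)
  ... | no a≢c | _ = no (λ eq → a≢c (cong proj₁ eq))
  ... | _ | no b≢e = no (λ eq → b≢e (cong proj₂ eq))

  fromℤᴷ : ℤ → K
  fromℤᴷ m = ι d (fromℤ m)

  ι-homo-+ : ∀ p q → ι d (p ℚ.+ q) ≡ ι d p + ι d q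
  ι-homo-+ p q = cong ((p ℚ.+ q) ,_) (sym (ℚP.+-identityʳ 0ℚ))

  ι-homo-* : ∀ p q → ι d (p ℚ.* q) ≡ ι d p * ι d q
  ι-homo-* p q = cong₂ _,_ (re δ p q) (im p q)
    where
    re : ∀ D p q → p ℚ.* q ≡ p ℚ.* q ℚ.- D ℚ.* (0ℚ ℚ.* 0ℚ)
    re = solve-∀ ℚ-ring
    im : ∀ p q → 0ℚ ≡ p ℚ.* 0ℚ ℚ.+ 0ℚ ℚ.* q
    im = solve-∀ ℚ-ring

  ι-injective : ∀ {p q} → ι d p ≡ ι d q → p ≡ q
  ι-injective = cong proj₁

  conj-+ : ∀ x y → conj d (x + y) ≡ conj d x + conj d y
  conj-+ (a , b) (c , e) = cong ((a ℚ.+ c) ,_) (ℚP.neg-distrib-+ b e)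

  conj-* : ∀ x y → conj d (x * y) ≡ conj d x * conj d y
  conj-* (a , b) (c , e) = cong₂ _,_ (re δ a b c e) (im a b c e)
    where
    re : ∀ D a b c e → a ℚ.* c ℚ.- D ℚ.* (b ℚ.* e) ≡ a ℚ.* c ℚ.- D ℚ.* (ℚ.- b ℚ.* ℚ.- e)
    re = solve-∀ ℚ-ring
    im : ∀ a b c e → ℚ.- (a ℚ.* e ℚ.+ b ℚ.* c) ≡ a ℚ.* ℚ.- e ℚ.+ ℚ.- b ℚ.* c
    im = solve-∀ ℚ-ring

  conj-involutive : ∀ x → conj d (conj d x) ≡ x
  conj-involutive (a , b) = cong (a ,_) (neg-involutive b)
    where
    neg-involutive : ∀ b → ℚ.- (ℚ.- b) ≡ b
    neg-involutive = solve-∀ ℚ-ring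

  self-conjugate⇒real : ∀ x → x ≡ conj d x → x ≡ ι d (proj₁ x)
  self-conjugate⇒real (a , b) x≡conj[x] = cong (a ,_) (Sum.[ ⊥-elim ∘ 2≢0 , id ]′ (p*q≡0⇒p≡0∨q≡0 2ℚ b 2b≡0))
    where
    2ℚ = 1ℚ ℚ.+ 1ℚ
    2≢0 : 2ℚ ≢ 0ℚ
    2≢0 ()
    2b≡b+b : ∀ b → 2ℚ ℚ.* b ≡ b ℚ.+ b
    2b≡b+b = solve-∀ ℚ-ring
    2b≡0 : 2ℚ ℚ.* b ≡ 0ℚ
    2b≡0 = trans (2b≡b+b b) (trans (cong (b ℚ.+_) (cong proj₂ x≡conj[x])) (ℚP.+-inverseʳ b))

  conj-neg : ∀ x → conj d (- x) ≡ - conj d x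
  conj-neg _ = refl

  conj-- : ∀ x y → conj d (x - y) ≡ conj d x - conj d y
  conj-- x y = conj-+ x (- y)

  N : K → ℚ
  N = NK d

  x*conj[x]≡N[x] : ∀ x → x * conj d x ≡ ι d (N x)
  x*conj[x]≡N[x] (a , b) = cong₂ _,_ (re δ a b) (im a b)
    where
    re : ∀ D a b → a ℚ.* a ℚ.- D ℚ.* (b ℚ.* ℚ.- b) ≡ a ℚ.* a ℚ.+ D ℚ.* (b ℚ.* b)
    re = solve-∀ ℚ-ring
    im : ∀ a b → a ℚ.* ℚ.- b ℚ.+ b ℚ.* a ≡ 0ℚ
    im = solve-∀ ℚ-ring

  fromℤᴷ-morphism : CommutativeRing.rawRing ℤP.+-*-commutativeRing -Raw-AlmostCommutative⟶ fromCommutativeRing commutativeRing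
  fromℤᴷ-morphism = record
    { ⟦_⟧ = fromℤᴷ
    ; +-homo = λ m n → trans (cong (ι d) (fromℤ-homo-+ m n)) (ι-homo-+ (fromℤ m) (fromℤ n))
    ; *-homo = λ m n → trans (cong (ι d) (fromℤ-homo-* m n)) (ι-homo-* (fromℤ m) (fromℤ n))
    ; -‿homo = λ m → cong (ι d) (fromℤ-homo‿- m)
    ; 0-homo = refl
    ; 1-homo = refl }

  -- Coefficients are taken in ℤ: the normaliser computes with its coefficients, and products of
  -- constants of K would get stuck on the symbolic δ.
  module K-Solver = RingSolver (CommutativeRing.rawRing ℤP.+-*-commutativeRing) (fromCommutativeRing commutativeRing) fromℤᴷ-morphism
    (λ m n → Maybe.map (cong fromℤᴷ) (dec⇒maybe (m ℤ.≟ n)))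

  interchange : ∀ x y z w → (x * y) * (z * w) ≡ (x * z) * (y * w)
  interchange = solve 4 (λ x y z w → (x :* y) :* (z :* w) := (x :* z) :* (y :* w)) refl
    where open K-Solver

  -1*x≡-x : ∀ x → fromℤᴷ (ℤ.- + 1) * x ≡ - x
  -1*x≡-x = solve 1 (λ x → con (ℤ.- + 1) :* x := :- x) refl
    where open K-Solver

  N-homo-* : ∀ x y → N (x * y) ≡ N x ℚ.* N y
  N-homo-* x y = ι-injective (begin
    ι d (N (x * y))                          ≡⟨ x*conj[x]≡N[x] (x * y) ⟨
    (x * y) * conj d (x * y)                 ≡⟨ cong ((x * y) *_) (conj-* x y) ⟩
    (x * y) * (conj d x * conj d y)          ≡⟨ interchange x y (conj d x) (conj d y) ⟩
    (x * conj d x) * (y * conj d y)          ≡⟨ cong₂ _*_ (x*conj[x]≡N[x] x) (x*conj[x]≡N[x] y) ⟩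
    ι d (N x) * ι d (N y)                    ≡⟨ ι-homo-* (N x) (N y) ⟨
    ι d (N x ℚ.* N y)                        ∎)
    where open ≡-Reasoning

  0≤δ : 0ℚ ℚ.≤ δ
  0≤δ = fromℤ-mono-≤ {+ 0} {+ d} (ℤ.+≤+ ℕ.z≤n)

  0≤N : ∀ x → 0ℚ ℚ.≤ N x
  0≤N (a , b) = ℚP.≤-trans (0≤p*p a) (subst (ℚ._≤ N (a , b)) (ℚP.+-identityʳ (a ℚ.* a))
    (ℚP.+-monoʳ-≤ (a ℚ.* a) (0≤p*q 0≤δ (0≤p*p b))))

  N-conj : ∀ x → N (conj d x) ≡ N x
  N-conj (a , b) = lemma δ a b
    where
    lemma : ∀ D a b → a ℚ.* a ℚ.+ D ℚ.* (ℚ.- b ℚ.* ℚ.- b) ≡ a ℚ.* a ℚ.+ D ℚ.* (b ℚ.* b)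
    lemma = solve-∀ ℚ-ring

  module Definite (d≥1 : 1 ℕ.≤ d) where

    δ≢0 : δ ≢ 0ℚ
    δ≢0 δ≡0 = ℕP.<⇒≢ d≥1 (sym (ℤP.+-injective (fromℤ-injective δ≡0)))

    N≡0⇒≡0 : ∀ x → N x ≡ 0ℚ → x ≡ 0#
    N≡0⇒≡0 (a , b) Nx≡0 = cong₂ _,_ (p*p≡0⇒p≡0 a aa≡0) b≡0
      where
      aa≡0 = p+q≡0⇒p≡0 (0≤p*p a) (0≤p*q 0≤δ (0≤p*p b)) Nx≡0
      δbb≡0 = p+q≡0⇒p≡0 (0≤p*q 0≤δ (0≤p*p b)) (0≤p*p a) (trans (ℚP.+-comm (δ ℚ.* (b ℚ.* b)) (a ℚ.* a)) Nx≡0)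
      b≡0 : b ≡ 0ℚ
      b≡0 = Sum.[ ⊥-elim ∘ δ≢0 , p*p≡0⇒p≡0 b ]′ (p*q≡0⇒p≡0∨q≡0 δ (b ℚ.* b) δbb≡0)

    N≢0 : ∀ {x} → x ≢ 0# → N x ≢ 0ℚ
    N≢0 x≢0 Nx≡0 = x≢0 (N≡0⇒≡0 _ Nx≡0)

    x*y≡0⇒x≡0∨y≡0 : ∀ x y → x * y ≡ 0# → x ≡ 0# ⊎ y ≡ 0#
    x*y≡0⇒x≡0∨y≡0 x y xy≡0 = Sum.map (N≡0⇒≡0 x) (N≡0⇒≡0 y) (p*q≡0⇒p≡0∨q≡0 (N x) (N y) NxNy≡0)
      where
      NxNy≡0 : N x ℚ.* N y ≡ 0ℚ
      NxNy≡0 = trans (sym (N-homo-* x y)) (trans (cong N xy≡0) (cong (0ℚ ℚ.+_) (ℚP.*-zeroʳ δ)))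

    x≢0∧y≢0⇒x*y≢0 : ∀ {x y} → x ≢ 0# → y ≢ 0# → x * y ≢ 0#
    x≢0∧y≢0⇒x*y≢0 {x} {y} x≢0 y≢0 xy≡0 = Sum.[ x≢0 , y≢0 ]′ (x*y≡0⇒x≡0∨y≡0 x y xy≡0)

    inverse : (x : K) → x ≢ 0# → K
    inverse x x≢0 = conj d x * ι d ((ℚ.1/ N x) {{ℚ.≢-nonZero (N≢0 x≢0)}})

    *-inverseʳ : ∀ x (x≢0 : x ≢ 0#) → x * inverse x x≢0 ≡ 1#
    *-inverseʳ x x≢0 = begin
      x * (conj d x * ι d Nx⁻¹)      ≡⟨ *-assoc x (conj d x) (ι d Nx⁻¹) ⟨
      (x * conj d x) * ι d Nx⁻¹      ≡⟨ cong (_* ι d Nx⁻¹) (x*conj[x]≡N[x] x) ⟩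
      ι d (N x) * ι d Nx⁻¹           ≡⟨ ι-homo-* (N x) Nx⁻¹ ⟨
      ι d (N x ℚ.* Nx⁻¹)             ≡⟨ cong (ι d) (ℚP.*-inverseʳ (N x) {{ℚ.≢-nonZero (N≢0 x≢0)}}) ⟩
      1#                             ∎
      where
      open ≡-Reasoning
      Nx⁻¹ = (ℚ.1/ N x) {{ℚ.≢-nonZero (N≢0 x≢0)}}

    *-inverse-cancel : ∀ x (x≢0 : x ≢ 0#) y → x * (y * inverse x x≢0) ≡ y
    *-inverse-cancel x x≢0 y = begin
      x * (y * inverse x x≢0)        ≡⟨ solve 3 (λ x y z → x :* (y :* z) := y :* (x :* z)) refl x y (inverse x x≢0) ⟩
      y * (x * inverse x x≢0)        ≡⟨ cong (y *_) (*-inverseʳ x x≢0) ⟩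
      y * 1#                         ≡⟨ *-identityʳ y ⟩
      y                              ∎
      where
      open ≡-Reasoning
      open K-Solver

  infixr 8 _^_

  _^_ : K → ℕ → K
  _^_ = powK d

  ∑ : (n : ℕ) → (Fin n → K) → K
  ∑ = ΣK d

  ^-distribˡ-+-* : ∀ x i j → x ^ (i ℕ.+ j) ≡ x ^ i * x ^ j
  ^-distribˡ-+-* x zero j = sym (*-identityˡ (x ^ j))
  ^-distribˡ-+-* x (suc i) j = trans (cong (x *_) (^-distribˡ-+-* x i j)) (sym (*-assoc x (x ^ i) (x ^ j)))

  ^-distribʳ-* : ∀ x y k → (x * y) ^ k ≡ x ^ k * y ^ k
  ^-distribʳ-* x y zero = sym (*-identityˡ 1#)
  ^-distribʳ-* x y (suc k) = trans (cong ((x * y) *_) (^-distribʳ-* x y k)) (interchange x y (x ^ k) (y ^ k))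

  conj-^ : ∀ x k → conj d (x ^ k) ≡ conj d x ^ k
  conj-^ x zero = refl
  conj-^ x (suc k) = trans (conj-* x (x ^ k)) (cong (conj d x *_) (conj-^ x k))

  ι-^ : ∀ r k → ι d r ^ k ≡ ι d (r ^ℚ k)
  ι-^ r zero = refl
  ι-^ r (suc k) = trans (cong (ι d r *_) (ι-^ r k)) (sym (ι-homo-* r (r ^ℚ k)))

  ∑-cong : ∀ n {f g : Fin n → K} → (∀ i → f i ≡ g i) → ∑ n f ≡ ∑ n g
  ∑-cong zero f≗g = refl
  ∑-cong (suc n) f≗g = cong₂ _+_ (f≗g zero) (∑-cong n (f≗g ∘ suc))

  *-distribˡ-∑ : ∀ n c (f : Fin n → K) → c * ∑ n f ≡ ∑ n (λ i → c * f i)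
  *-distribˡ-∑ zero c f = zeroʳ c
  *-distribˡ-∑ (suc n) c f = trans (*-distribˡ-+ c (f zero) (∑ n (f ∘ suc))) (cong (_+_ (c * f zero)) (*-distribˡ-∑ n c (f ∘ suc)))

  ∑-+ : ∀ n (f g : Fin n → K) → ∑ n f + ∑ n g ≡ ∑ n (λ i → f i + g i)
  ∑-+ zero f g = +-identityˡ 0#
  ∑-+ (suc n) f g = trans (solve 4 (λ a b c e → (a :+ b) :+ (c :+ e) := (a :+ c) :+ (b :+ e)) refl (f zero) (∑ n (f ∘ suc)) (g zero) (∑ n (g ∘ suc)))
    (cong (_+_ (f zero + g zero)) (∑-+ n (f ∘ suc) (g ∘ suc)))
    where open K-Solver

  ∑-zero : ∀ n (f : Fin n → K) → ∑ n (λ i → 0# * f i) ≡ 0#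
  ∑-zero zero f = refl
  ∑-zero (suc n) f = trans (cong₂ _+_ (zeroˡ (f zero)) (∑-zero n (f ∘ suc))) (+-identityˡ 0#)

  record HasDenominator (D : ℕ) (x : K) : Set where
    constructor _,_
    field
      re-integer : IsInteger (fromℤ (+ D) ℚ.* proj₁ x)
      im-integer : IsInteger (fromℤ (+ D) ℚ.* proj₂ x)

  denominator-resp : ∀ {D x y} → x ≡ y → HasDenominator D x → HasDenominator D y
  denominator-resp refl D-x = D-x

  denominator-0 : ∀ {D} → HasDenominator D 0#
  denominator-0 {D} = zero-integer , zero-integer
    where
    zero-integer : IsInteger (fromℤ (+ D) ℚ.* 0ℚ)
    zero-integer = + 0 , ℚP.*-zeroʳ (fromℤ (+ D))

  denominator-+ : ∀ {D} x y → HasDenominator D x → HasDenominator D y → HasDenominator D (x + y)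
  denominator-+ {D} (a , b) (c , e) (Da , Db) (Dc , De) =
    subst IsInteger (sym (ℚP.*-distribˡ-+ (fromℤ (+ D)) a c)) (integer-+ Da Dc) ,
    subst IsInteger (sym (ℚP.*-distribˡ-+ (fromℤ (+ D)) b e)) (integer-+ Db De)

  denominator-neg : ∀ {D} x → HasDenominator D x → HasDenominator D (- x)
  denominator-neg {D} (a , b) (Da , Db) =
    subst IsInteger (ℚP.neg-distribʳ-* (fromℤ (+ D)) a) (integer-neg Da) ,
    subst IsInteger (ℚP.neg-distribʳ-* (fromℤ (+ D)) b) (integer-neg Db)

  denominator-conj : ∀ {D} x → HasDenominator D x → HasDenominator D (conj d x)
  denominator-conj {D} (a , b) (Da , Db) = Da , subst IsInteger (ℚP.neg-distribʳ-* (fromℤ (+ D)) b) (integer-neg Db)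

  denominator-* : ∀ {D E} x y → HasDenominator D x → HasDenominator E y → HasDenominator (D ℕ.* E) (x * y)
  denominator-* {D} {E} (a , b) (c , e) (Da , Db) (Ec , Ee) =
    subst IsInteger (sym (trans (cong (ℚ._* (a ℚ.* c ℚ.- δ ℚ.* (b ℚ.* e))) (fromℤ-+-* D E)) (re (fromℤ (+ D)) (fromℤ (+ E)) δ a b c e)))
      (integer-+ (integer-* Da Ec) (integer-neg (integer-* (+ d , refl) (integer-* Db Ee)))) ,
    subst IsInteger (sym (trans (cong (ℚ._* (a ℚ.* e ℚ.+ b ℚ.* c)) (fromℤ-+-* D E)) (im (fromℤ (+ D)) (fromℤ (+ E)) a b c e)))
      (integer-+ (integer-* Da Ee) (integer-* Db Ec))
    where
    re : ∀ P Q D a b c e → (P ℚ.* Q) ℚ.* (a ℚ.* c ℚ.- D ℚ.* (b ℚ.* e))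
                          ≡ (P ℚ.* a) ℚ.* (Q ℚ.* c) ℚ.+ ℚ.- (D ℚ.* ((P ℚ.* b) ℚ.* (Q ℚ.* e)))
    re = solve-∀ ℚ-ring
    im : ∀ P Q a b c e → (P ℚ.* Q) ℚ.* (a ℚ.* e ℚ.+ b ℚ.* c) ≡ (P ℚ.* a) ℚ.* (Q ℚ.* e) ℚ.+ (P ℚ.* b) ℚ.* (Q ℚ.* c)
    im = solve-∀ ℚ-ring

  denominator-fromℤ-* : ∀ {D} m x → HasDenominator D x → HasDenominator D (fromℤᴷ m * x)
  denominator-fromℤ-* {D} m (a , b) (Da , Db) =
    subst IsInteger (sym (re (fromℤ (+ D)) (fromℤ m) δ a b)) (integer-* (m , refl) Da) ,
    subst IsInteger (sym (im (fromℤ (+ D)) (fromℤ m) a b)) (integer-* (m , refl) Db)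
    where
    re : ∀ P M D a b → P ℚ.* (M ℚ.* a ℚ.- D ℚ.* (0ℚ ℚ.* b)) ≡ M ℚ.* (P ℚ.* a)
    re = solve-∀ ℚ-ring
    im : ∀ P M a b → P ℚ.* (M ℚ.* b ℚ.+ 0ℚ ℚ.* a) ≡ M ℚ.* (P ℚ.* b)
    im = solve-∀ ℚ-ring

  integer-*ʳ : ∀ D E a → IsInteger (fromℤ (+ D) ℚ.* a) → IsInteger (fromℤ (+ (D ℕ.* E)) ℚ.* a)
  integer-*ʳ D E a Da = subst IsInteger (sym (begin
    fromℤ (+ (D ℕ.* E)) ℚ.* a                  ≡⟨ cong (ℚ._* a) (fromℤ-+-* D E) ⟩
    (fromℤ (+ D) ℚ.* fromℤ (+ E)) ℚ.* a         ≡⟨ rearrange (fromℤ (+ D)) (fromℤ (+ E)) a ⟩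
    (fromℤ (+ D) ℚ.* a) ℚ.* fromℤ (+ E)         ∎)) (integer-* Da (+ E , refl))
    where
    open ≡-Reasoning
    rearrange : ∀ P Q a → (P ℚ.* Q) ℚ.* a ≡ (P ℚ.* a) ℚ.* Q
    rearrange = solve-∀ ℚ-ring

  denominator-*ʳ : ∀ {D} E x → HasDenominator D x → HasDenominator (D ℕ.* E) x
  denominator-*ʳ {D} E (a , b) (Da , Db) = integer-*ʳ D E a Da , integer-*ʳ D E b Db

  denominator-*ˡ : ∀ {D} E x → HasDenominator D x → HasDenominator (E ℕ.* D) x
  denominator-*ˡ {D} E x D-x = subst (λ F → HasDenominator F x) (ℕP.*-comm D E) (denominator-*ʳ E x D-x)

  denominator-∑ : ∀ {D} n (f : Fin n → K) → (∀ i → HasDenominator D (f i)) → HasDenominator D (∑ n f)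
  denominator-∑ {D} zero f D-f = denominator-0 {D}
  denominator-∑ {D} (suc n) f D-f = denominator-+ {D} (f zero) (∑ n (f ∘ suc)) (D-f zero) (denominator-∑ {D} n (f ∘ suc) (D-f ∘ suc))

  denominatorOf : K → ℕ
  denominatorOf (a , b) = ℚ.↧ₙ a ℕ.* ℚ.↧ₙ b

  1≤denominatorOf : ∀ x → 1 ℕ.≤ denominatorOf x
  1≤denominatorOf (a , b) = ℕP.*-mono-≤ {1} {ℚ.↧ₙ a} {1} {ℚ.↧ₙ b} (ℕ.s≤s ℕ.z≤n) (ℕ.s≤s ℕ.z≤n)

  denominatorOf-denominator : ∀ x → HasDenominator (denominatorOf x) x
  denominatorOf-denominator (a , b) =
    integer-*ʳ (ℚ.↧ₙ a) (ℚ.↧ₙ b) a (subst IsInteger (sym (↧p*p≡↥p a)) (ℚ.↥ a , refl)) ,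
    subst (λ D → IsInteger (fromℤ (+ D) ℚ.* b)) (ℕP.*-comm (ℚ.↧ₙ b) (ℚ.↧ₙ a))
      (integer-*ʳ (ℚ.↧ₙ b) (ℚ.↧ₙ a) b (subst IsInteger (sym (↧p*p≡↥p b)) (ℚ.↥ b , refl)))

  denominatorOfAll : ∀ n → (Fin n → K) → ℕ
  denominatorOfAll zero _ = 1
  denominatorOfAll (suc n) f = denominatorOf (f zero) ℕ.* denominatorOfAll n (f ∘ suc)

  1≤denominatorOfAll : ∀ n f → 1 ℕ.≤ denominatorOfAll n f
  1≤denominatorOfAll zero _ = ℕP.≤-refl
  1≤denominatorOfAll (suc n) f = ℕP.*-mono-≤ {1} {denominatorOf (f zero)} (1≤denominatorOf (f zero)) (1≤denominatorOfAll n (f ∘ suc))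

  denominatorOfAll-denominator : ∀ n f i → HasDenominator (denominatorOfAll n f) (f i)
  denominatorOfAll-denominator (suc n) f zero = denominator-*ʳ (denominatorOfAll n (f ∘ suc)) (f zero) (denominatorOf-denominator (f zero))
  denominatorOfAll-denominator (suc n) f (suc i) = denominator-*ˡ (denominatorOf (f zero)) (f (suc i)) (denominatorOfAll-denominator n (f ∘ suc) i)

  record BoundedPowers (x : K) : Set where
    constructor boundedPowers
    field
      denominator : ℕ
      1≤denominator : 1 ℕ.≤ denominator
      powers : ∀ k → HasDenominator denominator (x ^ k)

  -- x^n = -(c₀ + c₁x + … + c_{n-1}x^{n-1}) lets every higher power be written with lower ones,
  -- so the product of the denominators of 1, x, …, x^{n-1} is a common denominator of all powers.
  integral⇒boundedPowers : ∀ x → InOK d x → BoundedPowers x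
  integral⇒boundedPowers x (n , c , monic) = boundedPowers D (1≤denominatorOfAll n powers<n) (<-rec _ power-denominator)
    where
    powers<n : Fin n → K
    powers<n i = x ^ toℕ i

    D = denominatorOfAll n powers<n

    lower : K
    lower = ∑ n (λ i → fromℤᴷ (c i) * x ^ toℕ i)

    x^n≡-lower : x ^ n ≡ - lower
    x^n≡-lower = begin
      x ^ n                      ≡⟨ solve 2 (λ a b → a := (a :+ b) :- b) refl (x ^ n) lower ⟩
      (x ^ n + lower) - lower    ≡⟨ cong (_- lower) monic ⟩
      0# - lower                 ≡⟨ +-identityˡ (- lower) ⟩
      - lower                    ∎
      where
      open ≡-Reasoning
      open K-Solver

    recurrence : ∀ j → x ^ (j ℕ.+ n) ≡ - ∑ n (λ i → fromℤᴷ (c i) * x ^ (j ℕ.+ toℕ i))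
    recurrence j = begin
      x ^ (j ℕ.+ n)                                          ≡⟨ ^-distribˡ-+-* x j n ⟩
      x ^ j * x ^ n                                          ≡⟨ cong (x ^ j *_) x^n≡-lower ⟩
      x ^ j * - lower                                        ≡⟨ solve 2 (λ a s → a :* (:- s) := :- (a :* s)) refl (x ^ j) lower ⟩
      - (x ^ j * lower)                                      ≡⟨ cong -_ (*-distribˡ-∑ n (x ^ j) _) ⟩
      - ∑ n (λ i → x ^ j * (fromℤᴷ (c i) * x ^ toℕ i))       ≡⟨ cong -_ (∑-cong n shift) ⟩
      - ∑ n (λ i → fromℤᴷ (c i) * x ^ (j ℕ.+ toℕ i))         ∎
      where
      open ≡-Reasoning
      open K-Solver
      shift : ∀ i → x ^ j * (fromℤᴷ (c i) * x ^ toℕ i) ≡ fromℤᴷ (c i) * x ^ (j ℕ.+ toℕ i)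
      shift i = trans (solve 3 (λ a b e → a :* (b :* e) := b :* (a :* e)) refl (x ^ j) (fromℤᴷ (c i)) (x ^ toℕ i))
                      (cong (fromℤᴷ (c i) *_) (sym (^-distribˡ-+-* x j (toℕ i))))

    power-denominator : ∀ k → (∀ {i} → i ℕ.< k → HasDenominator D (x ^ i)) → HasDenominator D (x ^ k)
    power-denominator k below with k ℕ.<? n
    ... | yes k<n = denominator-resp (cong (x ^_) (FinP.toℕ-fromℕ< k<n)) (denominatorOfAll-denominator n powers<n (Fin.fromℕ< k<n))
    ... | no k≮n = denominator-resp (trans (sym (recurrence (k ℕ.∸ n))) (cong (x ^_) j+n≡k))
      (denominator-neg _ (denominator-∑ n _ (λ i → denominator-fromℤ-* (c i) _ (below (j+i<k i)))))
      where
      j+n≡k : k ℕ.∸ n ℕ.+ n ≡ k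
      j+n≡k = ℕP.m∸n+n≡m (ℕP.≮⇒≥ k≮n)
      j+i<k : ∀ (i : Fin n) → k ℕ.∸ n ℕ.+ toℕ i ℕ.< k
      j+i<k i = subst (k ℕ.∸ n ℕ.+ toℕ i ℕ.<_) j+n≡k (ℕP.+-monoʳ-< (k ℕ.∸ n) (FinP.toℕ<n i))

  denominator-binomial : ∀ D x y → (∀ i j → HasDenominator D (x ^ i * y ^ j)) →
                         ∀ k i j → HasDenominator D ((x + y) ^ k * x ^ i * y ^ j)
  denominator-binomial D x y D-xy zero i j = denominator-resp (cong (_* y ^ j) (sym (*-identityˡ (x ^ i)))) (D-xy i j)
  denominator-binomial D x y D-xy (suc k) i j = denominator-resp (sym expand)
    (denominator-+ _ _ (denominator-binomial D x y D-xy k (suc i) j) (denominator-binomial D x y D-xy k i (suc j)))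
    where
    open K-Solver
    expand : (x + y) * (x + y) ^ k * x ^ i * y ^ j ≡ (x + y) ^ k * (x * x ^ i) * y ^ j + (x + y) ^ k * x ^ i * (y * y ^ j)
    expand = solve 5 (λ x y p a b → (x :+ y) :* p :* a :* b := p :* (x :* a) :* b :+ p :* a :* (y :* b)) refl x y ((x + y) ^ k) (x ^ i) (y ^ j)

  boundedPowers-+ : ∀ x y → BoundedPowers x → BoundedPowers y → BoundedPowers (x + y)
  boundedPowers-+ x y (boundedPowers D 1≤D D-x) (boundedPowers E 1≤E E-y) =
    boundedPowers (D ℕ.* E) (ℕP.*-mono-≤ {1} {D} {1} {E} 1≤D 1≤E) λ k →
      denominator-resp (trans (*-identityʳ _) (*-identityʳ _))
        (denominator-binomial (D ℕ.* E) x y (λ i j → denominator-* (x ^ i) (y ^ j) (D-x i) (E-y j)) k 0 0)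

  boundedPowers-* : ∀ x y → BoundedPowers x → BoundedPowers y → BoundedPowers (x * y)
  boundedPowers-* x y (boundedPowers D 1≤D D-x) (boundedPowers E 1≤E E-y) =
    boundedPowers (D ℕ.* E) (ℕP.*-mono-≤ {1} {D} {1} {E} 1≤D 1≤E) λ k →
      denominator-resp (sym (^-distribʳ-* x y k)) (denominator-* (x ^ k) (y ^ k) (D-x k) (E-y k))

  trace : K → ℚ
  trace x = proj₁ x ℚ.+ proj₁ x

  x+conj[x]≡trace[x] : ∀ x → x + conj d x ≡ ι d (trace x)
  x+conj[x]≡trace[x] (a , b) = cong (a ℚ.+ a ,_) (ℚP.+-inverseʳ b)

  record IntegralTraceNorm (x : K) : Set where
    constructor integralTraceNorm
    field
      trace-integer : IsInteger (trace x)
      norm-integer : IsInteger (N x)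

  integralTraceNorm? : ∀ x → Dec (IntegralTraceNorm x)
  integralTraceNorm? x with integer? (trace x) | integer? (N x)
  ... | yes t | yes n = yes (integralTraceNorm t n)
  ... | no ¬t | _ = no (λ tn → ¬t (IntegralTraceNorm.trace-integer tn))
  ... | _ | no ¬n = no (λ tn → ¬n (IntegralTraceNorm.norm-integer tn))

  -- The trace and the norm are the rational numbers x + x̄ and x x̄, whose powers have bounded denominators.
  boundedPowers⇒integralTraceNorm : ∀ x → BoundedPowers x → IntegralTraceNorm x
  boundedPowers⇒integralTraceNorm x (boundedPowers D 1≤D D-x) = integralTraceNorm
    (bounded-powers⇒integer D² 1≤D² (trace x) λ k → HasDenominator.re-integer (denominator-resp
      (trans (trans (*-identityʳ _) (*-identityʳ _)) (trans (cong (_^ k) (x+conj[x]≡trace[x] x)) (ι-^ (trace x) k)))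
      (denominator-binomial D² x (conj d x) D²-x-conj[x] k 0 0)))
    (bounded-powers⇒integer D² 1≤D² (N x) λ k → HasDenominator.re-integer (denominator-resp
      (trans (sym (^-distribʳ-* x (conj d x) k)) (trans (cong (_^ k) (x*conj[x]≡N[x] x)) (ι-^ (N x) k)))
      (D²-x-conj[x] k k)))
    where
    D² = D ℕ.* D
    1≤D² = ℕP.*-mono-≤ {1} {D} {1} {D} 1≤D 1≤D
    D²-x-conj[x] : ∀ i j → HasDenominator D² (x ^ i * conj d x ^ j)
    D²-x-conj[x] i j = denominator-* (x ^ i) (conj d x ^ j) (D-x i) (denominator-resp (conj-^ x j) (denominator-conj (x ^ j) (D-x j)))

  integralTraceNorm⇒integral : ∀ x → IntegralTraceNorm x → InOK d x
  integralTraceNorm⇒integral x (integralTraceNorm (t , trace≡t) (n , N≡n)) = 2 , coefficients , quadratic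
    where
    coefficients : Fin 2 → ℤ
    coefficients zero = n
    coefficients (suc zero) = ℤ.- t
    quadratic : x * (x * 1#) + (fromℤᴷ n * 1# + (fromℤᴷ (ℤ.- t) * (x * 1#) + 0#)) ≡ 0#
    quadratic = begin
      x * (x * 1#) + (fromℤᴷ n * 1# + (fromℤᴷ (ℤ.- t) * (x * 1#) + 0#))
        ≡⟨ cong₂ (λ u w → x * (x * 1#) + (u * 1# + (w * (x * 1#) + 0#))) n≡ -t≡ ⟩
      x * (x * 1#) + ((x * conj d x) * 1# + (- (x + conj d x) * (x * 1#) + 0#))
        ≡⟨ solve 2 (λ x y → x :* (x :* con (+ 1)) :+ ((x :* y) :* con (+ 1) :+ ((:- (x :+ y)) :* (x :* con (+ 1)) :+ con (+ 0))) := con (+ 0)) refl x (conj d x) ⟩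
      0#
        ∎
      where
      open ≡-Reasoning
      open K-Solver
      n≡ : fromℤᴷ n ≡ x * conj d x
      n≡ = trans (cong (ι d) (sym N≡n)) (sym (x*conj[x]≡N[x] x))
      -t≡ : fromℤᴷ (ℤ.- t) ≡ - (x + conj d x)
      -t≡ = trans (cong (ι d) (trans (fromℤ-homo‿- t) (cong ℚ.-_ (sym trace≡t)))) (cong -_ (sym (x+conj[x]≡trace[x] x)))

  integral⇒integralTraceNorm : ∀ x → InOK d x → IntegralTraceNorm x
  integral⇒integralTraceNorm x = boundedPowers⇒integralTraceNorm x ∘ integral⇒boundedPowers x

  integral-+ : ∀ x y → InOK d x → InOK d y → InOK d (x + y)
  integral-+ x y x∈O y∈O = integralTraceNorm⇒integral (x + y) (boundedPowers⇒integralTraceNorm (x + y)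
    (boundedPowers-+ x y (integral⇒boundedPowers x x∈O) (integral⇒boundedPowers y y∈O)))

  integral-* : ∀ x y → InOK d x → InOK d y → InOK d (x * y)
  integral-* x y x∈O y∈O = integralTraceNorm⇒integral (x * y) (boundedPowers⇒integralTraceNorm (x * y)
    (boundedPowers-* x y (integral⇒boundedPowers x x∈O) (integral⇒boundedPowers y y∈O)))

  integral-fromℤ : ∀ m → InOK d (fromℤᴷ m)
  integral-fromℤ m = integralTraceNorm⇒integral (fromℤᴷ m) (integralTraceNorm
    (m ℤ.+ m , sym (fromℤ-homo-+ m m)) (m ℤ.* m , trans N≡ (sym (fromℤ-homo-* m m))))
    where
    N≡ : N (fromℤᴷ m) ≡ fromℤ m ℚ.* fromℤ m
    N≡ = trans (cong (fromℤ m ℚ.* fromℤ m ℚ.+_) (ℚP.*-zeroʳ δ)) (ℚP.+-identityʳ _)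

  integral-0 : InOK d 0#
  integral-0 = integral-fromℤ (+ 0)

  integral-1 : InOK d 1#
  integral-1 = integral-fromℤ (+ 1)

  integral-neg : ∀ x → InOK d x → InOK d (- x)
  integral-neg x x∈O = subst (InOK d) (-1*x≡-x x) (integral-* (fromℤᴷ (ℤ.- + 1)) x (integral-fromℤ (ℤ.- + 1)) x∈O)

  integral-conj : ∀ x → InOK d x → InOK d (conj d x)
  integral-conj x x∈O = integralTraceNorm⇒integral (conj d x) (integralTraceNorm
    (trace-integer tn) (subst IsInteger (sym (N-conj x)) (norm-integer tn)))
    where
    tn = integral⇒integralTraceNorm x x∈O
    open IntegralTraceNorm

  integral-- : ∀ x y → InOK d x → InOK d y → InOK d (x - y)
  integral-- x y x∈O y∈O = integral-+ x (- y) x∈O (integral-neg y y∈O)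

  integral-∑ : ∀ n (f : Fin n → K) → (∀ i → InOK d (f i)) → InOK d (∑ n f)
  integral-∑ zero f f∈O = integral-0
  integral-∑ (suc n) f f∈O = integral-+ (f zero) (∑ n (f ∘ suc)) (f∈O zero) (integral-∑ n (f ∘ suc) (f∈O ∘ suc))

  denominator⇒integral : ∀ D x → HasDenominator D x → InOK d (fromℤᴷ (+ D) * x)
  denominator⇒integral D (a , b) (Da , Db) = integralTraceNorm⇒integral _ (integralTraceNorm
    (subst IsInteger (sym (cong trace Dx≡)) (integer-+ Da Da))
    (subst IsInteger (sym (cong N Dx≡)) (integer-+ (integer-* Da Da) (integer-* (+ d , refl) (integer-* Db Db)))))
    where
    P = fromℤ (+ D)
    Dx≡ : fromℤᴷ (+ D) * (a , b) ≡ (P ℚ.* a , P ℚ.* b)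
    Dx≡ = cong₂ _,_ (re P δ a b) (im P a b)
      where
      re : ∀ P D a b → P ℚ.* a ℚ.- D ℚ.* (0ℚ ℚ.* b) ≡ P ℚ.* a
      re = solve-∀ ℚ-ring
      im : ∀ P a b → P ℚ.* b ℚ.+ 0ℚ ℚ.* a ≡ P ℚ.* b
      im = solve-∀ ℚ-ring

  integral⇒N≡ℕ : ∀ x → InOK d x → Σ ℕ λ n → N x ≡ fromℤ (+ n)
  integral⇒N≡ℕ x x∈O = 0≤integer⇒ℕ (0≤N x) (IntegralTraceNorm.norm-integer (integral⇒integralTraceNorm x x∈O))

  integral-positive-rational⇒1≤ : ∀ q → InOK d (ι d q) → 0ℚ ℚ.< q → 1ℚ ℚ.≤ q
  integral-positive-rational⇒1≤ q q∈O 0<q = 0<p∧p*p-integer⇒1≤p q 0<q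
    (subst IsInteger N≡ (IntegralTraceNorm.norm-integer (integral⇒integralTraceNorm (ι d q) q∈O)))
    where
    N≡ : N (ι d q) ≡ q ℚ.* q
    N≡ = trans (cong (q ℚ.* q ℚ.+_) (ℚP.*-zeroʳ δ)) (ℚP.+-identityʳ (q ℚ.* q))

  integral-multiple⇒≤ : ∀ {p q} μ → 0ℚ ℚ.< p → 0ℚ ℚ.< q → InOK d μ → ι d p ≡ ι d q * μ → q ℚ.≤ p
  integral-multiple⇒≤ {p} {q} (μ₁ , μ₂) 0<p 0<q μ∈O p≡qμ = begin
    q                ≡⟨ ℚP.*-identityʳ q ⟨
    q ℚ.* 1ℚ         ≤⟨ ℚP.*-monoˡ-≤-nonNeg q {{ℚ.nonNegative (ℚP.<⇒≤ 0<q)}} 1≤μ₁ ⟩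
    q ℚ.* μ₁         ≡⟨ p≡qμ₁ ⟨
    p                ∎
    where
    open ℚP.≤-Reasoning
    q≢0 : q ≢ 0ℚ
    q≢0 q≡0 = ℚP.<-irrefl (sym q≡0) 0<q
    μ₂≡0 : μ₂ ≡ 0ℚ
    μ₂≡0 = Sum.[ ⊥-elim ∘ q≢0 , id ]′ (p*q≡0⇒p≡0∨q≡0 q μ₂ (trans (im q μ₁ μ₂) (sym (cong proj₂ p≡qμ))))
      where
      im : ∀ q μ₁ μ₂ → q ℚ.* μ₂ ≡ q ℚ.* μ₂ ℚ.+ 0ℚ ℚ.* μ₁
      im = solve-∀ ℚ-ring
    p≡qμ₁ : p ≡ q ℚ.* μ₁
    p≡qμ₁ = trans (cong proj₁ p≡qμ) (trans (cong (λ z → q ℚ.* μ₁ ℚ.- δ ℚ.* (0ℚ ℚ.* z)) μ₂≡0) (re δ q μ₁))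
      where
      re : ∀ D q μ₁ → q ℚ.* μ₁ ℚ.- D ℚ.* (0ℚ ℚ.* 0ℚ) ≡ q ℚ.* μ₁
      re = solve-∀ ℚ-ring
    0<μ₁ : 0ℚ ℚ.< μ₁
    0<μ₁ = ℚP.*-cancelˡ-<-nonNeg q {{ℚ.nonNegative (ℚP.<⇒≤ 0<q)}} (subst₂ ℚ._<_ (sym (ℚP.*-zeroʳ q)) p≡qμ₁ 0<p)
    1≤μ₁ : 1ℚ ℚ.≤ μ₁
    1≤μ₁ = integral-positive-rational⇒1≤ μ₁ (subst (InOK d) (cong (μ₁ ,_) μ₂≡0) μ∈O) 0<μ₁

  module Ideal {j : ℕ} (a : Fin j → K) where

    private
      kronecker : ∀ {n} → Fin n → Fin n → K
      kronecker zero zero = 1#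
      kronecker zero (suc _) = 0#
      kronecker (suc _) zero = 0#
      kronecker (suc i) (suc i′) = kronecker i i′

      integral-kronecker : ∀ {n} (i i′ : Fin n) → InOK d (kronecker i i′)
      integral-kronecker zero zero = integral-1
      integral-kronecker zero (suc _) = integral-0
      integral-kronecker (suc _) zero = integral-0
      integral-kronecker (suc i) (suc i′) = integral-kronecker i i′

      ∑-kronecker : ∀ n (i : Fin n) (f : Fin n → K) → ∑ n (λ i′ → kronecker i i′ * f i′) ≡ f i
      ∑-kronecker (suc n) zero f = trans (cong₂ _+_ (*-identityˡ (f zero)) (∑-zero n (f ∘ suc))) (+-identityʳ (f zero))
      ∑-kronecker (suc n) (suc i) f = trans (cong₂ _+_ (zeroˡ (f zero)) (∑-kronecker n i (f ∘ suc))) (+-identityˡ (f (suc i)))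

    ideal-0 : InIdeal d j a 0#
    ideal-0 = (λ _ → 0#) , (λ _ → integral-0) , sym (∑-zero j a)

    ideal-generator : ∀ i → InIdeal d j a (a i)
    ideal-generator i = kronecker i , integral-kronecker i , sym (∑-kronecker j i a)

    ideal-+ : ∀ {x y} → InIdeal d j a x → InIdeal d j a y → InIdeal d j a (x + y)
    ideal-+ (β , β∈O , refl) (β′ , β′∈O , refl) =
      (λ i → β i + β′ i) , (λ i → integral-+ (β i) (β′ i) (β∈O i) (β′∈O i)) ,
      trans (∑-+ j _ _) (∑-cong j (λ i → sym (*-distribʳ-+ (a i) (β i) (β′ i))))

    ideal-* : ∀ c {x} → InOK d c → InIdeal d j a x → InIdeal d j a (c * x)
    ideal-* c c∈O (β , β∈O , refl) =
      (λ i → c * β i) , (λ i → integral-* c (β i) c∈O (β∈O i)) ,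
      trans (*-distribˡ-∑ j c _) (∑-cong j (λ i → sym (*-assoc c (β i) (a i))))

    ideal-neg : ∀ {x} → InIdeal d j a x → InIdeal d j a (- x)
    ideal-neg {x} x∈a = subst (InIdeal d j a) (-1*x≡-x x) (ideal-* (fromℤᴷ (ℤ.- + 1)) (integral-fromℤ (ℤ.- + 1)) x∈a)

    ideal-- : ∀ {x y} → InIdeal d j a x → InIdeal d j a y → InIdeal d j a (x - y)
    ideal-- x∈a y∈a = ideal-+ x∈a (ideal-neg y∈a)

    ideal-denominator : ∀ {x} → InIdeal d j a x → InOK d (fromℤᴷ (+ denominatorOfAll j a) * x)
    ideal-denominator (β , β∈O , refl) = subst (InOK d) (sym (trans (*-distribˡ-∑ j M _) (∑-cong j swap)))
      (integral-∑ j _ (λ i → integral-* (β i) (M * a i) (β∈O i) (denominator⇒integral (denominatorOfAll j a) (a i) (denominatorOfAll-denominator j a i))))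
      where
      M = fromℤᴷ (+ denominatorOfAll j a)
      swap : ∀ i → M * (β i * a i) ≡ β i * (M * a i)
      swap i = solve 3 (λ M b a → M :* (b :* a) := b :* (M :* a)) refl M (β i) (a i)
        where open K-Solver

  infixl 6 _⊕_
  infixr 7 _·_

  _⊕_ : V d → V d → V d
  _⊕_ = _+V_ d

  _·_ : K → V d → V d
  _·_ = _·V_ d

  module Sesquilinear (H : Gram d) where

    h : V d → V d → K
    h = hf d H

    private
      -- h (v₁ , v₂) (w₁ , w₂) unfolds definitionally to form v₁ v₂ H₀₀ H₀₁ H₁₀ H₁₁ (conj d w₁) (conj d w₂).
      form : (v₁ v₂ h₀₀ h₀₁ h₁₀ h₁₁ w₁ w₂ : K) → K
      form v₁ v₂ h₀₀ h₀₁ h₁₀ h₁₁ w₁ w₂ = (v₁ * h₀₀ * w₁ + (v₁ * h₀₁ * w₂ + 0#)) + ((v₂ * h₁₀ * w₁ + (v₂ * h₁₁ * w₂ + 0#)) + 0#)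

      H₀₀ H₀₁ H₁₀ H₁₁ : K
      H₀₀ = H zero zero
      H₀₁ = H zero (suc zero)
      H₁₀ = H (suc zero) zero
      H₁₁ = H (suc zero) (suc zero)

      conj-form : ∀ v₁ v₂ h₀₀ h₀₁ h₁₀ h₁₁ w₁ w₂ → conj d (form v₁ v₂ h₀₀ h₀₁ h₁₀ h₁₁ w₁ w₂)
                  ≡ form (conj d v₁) (conj d v₂) (conj d h₀₀) (conj d h₀₁) (conj d h₁₀) (conj d h₁₁) (conj d w₁) (conj d w₂)
      conj-form v₁ v₂ h₀₀ h₀₁ h₁₀ h₁₁ w₁ w₂ =
        trans (conj-+ (row v₁ h₀₀ h₀₁) (row v₂ h₁₀ h₁₁ + 0#))
              (cong₂ _+_ (conj-row v₁ h₀₀ h₀₁) (trans (conj-+ (row v₂ h₁₀ h₁₁) 0#) (cong (_+ 0#) (conj-row v₂ h₁₀ h₁₁))))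
        where
        row : K → K → K → K
        row v k l = v * k * w₁ + (v * l * w₂ + 0#)
        conj-term : ∀ v k w → conj d (v * k * w) ≡ conj d v * conj d k * conj d w
        conj-term v k w = trans (conj-* (v * k) w) (cong (_* conj d w) (conj-* v k))
        conj-row : ∀ v k l → conj d (row v k l) ≡ conj d v * conj d k * conj d w₁ + (conj d v * conj d l * conj d w₂ + 0#)
        conj-row v k l = trans (conj-+ (v * k * w₁) (v * l * w₂ + 0#))
          (cong₂ _+_ (conj-term v k w₁) (trans (conj-+ (v * l * w₂) 0#) (cong (_+ 0#) (conj-term v l w₂))))

    h-+ˡ : ∀ u w z → h (u ⊕ w) z ≡ h u z + h w z
    h-+ˡ (u₁ , u₂) (w₁ , w₂) (z₁ , z₂) = solve 10 (λ u₁ u₂ w₁ w₂ a b c e p q →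
        (((u₁ :+ w₁) :* a :* p) :+ (((u₁ :+ w₁) :* b :* q) :+ con (+ 0))) :+ ((((u₂ :+ w₂) :* c :* p) :+ (((u₂ :+ w₂) :* e :* q) :+ con (+ 0))) :+ con (+ 0))
        := ((u₁ :* a :* p :+ (u₁ :* b :* q :+ con (+ 0))) :+ ((u₂ :* c :* p :+ (u₂ :* e :* q :+ con (+ 0))) :+ con (+ 0)))
           :+ ((w₁ :* a :* p :+ (w₁ :* b :* q :+ con (+ 0))) :+ ((w₂ :* c :* p :+ (w₂ :* e :* q :+ con (+ 0))) :+ con (+ 0))))
      refl u₁ u₂ w₁ w₂ H₀₀ H₀₁ H₁₀ H₁₁ (conj d z₁) (conj d z₂)
      where open K-Solver

    h-·ˡ : ∀ c u z → h (c · u) z ≡ c * h u z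
    h-·ˡ c (u₁ , u₂) (z₁ , z₂) = solve 9 (λ k u₁ u₂ a b c e p q →
        ((k :* u₁ :* a :* p) :+ ((k :* u₁ :* b :* q) :+ con (+ 0))) :+ (((k :* u₂ :* c :* p) :+ ((k :* u₂ :* e :* q) :+ con (+ 0))) :+ con (+ 0))
        := k :* ((u₁ :* a :* p :+ (u₁ :* b :* q :+ con (+ 0))) :+ ((u₂ :* c :* p :+ (u₂ :* e :* q :+ con (+ 0))) :+ con (+ 0))))
      refl c u₁ u₂ H₀₀ H₀₁ H₁₀ H₁₁ (conj d z₁) (conj d z₂)
      where open K-Solver

    module Hermitian (H-hermitian : IsHermitian d H) where

      h-swap : ∀ v w → h w v ≡ conj d (h v w)
      h-swap (v₁ , v₂) (w₁ , w₂) = sym (begin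
        conj d (form v₁ v₂ H₀₀ H₀₁ H₁₀ H₁₁ (conj d w₁) (conj d w₂))
          ≡⟨ conj-form v₁ v₂ H₀₀ H₀₁ H₁₀ H₁₁ (conj d w₁) (conj d w₂) ⟩
        form (conj d v₁) (conj d v₂) (conj d H₀₀) (conj d H₀₁) (conj d H₁₀) (conj d H₁₁) (conj d (conj d w₁)) (conj d (conj d w₂))
          ≡⟨ cong₂ (λ p q → form (conj d v₁) (conj d v₂) p q (conj d H₁₀) (conj d H₁₁) (conj d (conj d w₁)) (conj d (conj d w₂)))
                   (sym (H-hermitian zero zero)) (sym (H-hermitian zero (suc zero))) ⟩
        form (conj d v₁) (conj d v₂) H₀₀ H₁₀ (conj d H₁₀) (conj d H₁₁) (conj d (conj d w₁)) (conj d (conj d w₂))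
          ≡⟨ cong₂ (λ p q → form (conj d v₁) (conj d v₂) H₀₀ H₁₀ p q (conj d (conj d w₁)) (conj d (conj d w₂)))
                   (sym (H-hermitian (suc zero) zero)) (sym (H-hermitian (suc zero) (suc zero))) ⟩
        form (conj d v₁) (conj d v₂) H₀₀ H₁₀ H₀₁ H₁₁ (conj d (conj d w₁)) (conj d (conj d w₂))
          ≡⟨ cong₂ (form (conj d v₁) (conj d v₂) H₀₀ H₁₀ H₀₁ H₁₁) (conj-involutive w₁) (conj-involutive w₂) ⟩
        form (conj d v₁) (conj d v₂) H₀₀ H₁₀ H₀₁ H₁₁ w₁ w₂
          ≡⟨ solve 8 (λ p q a b c e w₁ w₂ →
               ((p :* a :* w₁) :+ ((p :* b :* w₂) :+ con (+ 0))) :+ (((q :* c :* w₁) :+ ((q :* e :* w₂) :+ con (+ 0))) :+ con (+ 0))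
               := ((w₁ :* a :* p) :+ ((w₁ :* c :* q) :+ con (+ 0))) :+ (((w₂ :* b :* p) :+ ((w₂ :* e :* q) :+ con (+ 0))) :+ con (+ 0)))
             refl (conj d v₁) (conj d v₂) H₀₀ H₁₀ H₀₁ H₁₁ w₁ w₂ ⟩
        form w₁ w₂ H₀₀ H₀₁ H₁₀ H₁₁ (conj d v₁) (conj d v₂)
          ∎)
        where
        open ≡-Reasoning
        open K-Solver

      h-+ʳ : ∀ z u w → h z (u ⊕ w) ≡ h z u + h z w
      h-+ʳ z u w = begin
        h z (u ⊕ w)                           ≡⟨ h-swap (u ⊕ w) z ⟩
        conj d (h (u ⊕ w) z)                  ≡⟨ cong (conj d) (h-+ˡ u w z) ⟩
        conj d (h u z + h w z)                ≡⟨ conj-+ (h u z) (h w z) ⟩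
        conj d (h u z) + conj d (h w z)       ≡⟨ cong₂ _+_ (h-swap u z) (h-swap w z) ⟨
        h z u + h z w                         ∎
        where open ≡-Reasoning

      h-·ʳ : ∀ z c u → h z (c · u) ≡ conj d c * h z u
      h-·ʳ z c u = begin
        h z (c · u)                           ≡⟨ h-swap (c · u) z ⟩
        conj d (h (c · u) z)                  ≡⟨ cong (conj d) (h-·ˡ c u z) ⟩
        conj d (c * h u z)                    ≡⟨ conj-* c (h u z) ⟩
        conj d c * conj d (h u z)             ≡⟨ cong (conj d c *_) (h-swap u z) ⟨
        conj d c * h z u                      ∎
        where open ≡-Reasoning

      h-diag : ∀ v → h v v ≡ ι d (qf d H v)
      h-diag v = self-conjugate⇒real (h v v) (h-swap v v)

      h-scale : ∀ c v → h (c · v) (c · v) ≡ ι d (N c) * h v v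
      h-scale c v = begin
        h (c · v) (c · v)                     ≡⟨ h-·ˡ c v (c · v) ⟩
        c * h v (c · v)                       ≡⟨ cong (c *_) (h-·ʳ v c v) ⟩
        c * (conj d c * h v v)                ≡⟨ *-assoc c (conj d c) (h v v) ⟨
        (c * conj d c) * h v v                ≡⟨ cong (_* h v v) (x*conj[x]≡N[x] c) ⟩
        ι d (N c) * h v v                     ∎
        where open ≡-Reasoning

      completing-square : ∀ m v w t a → h v v ≡ ι d m → ι d m * t ≡ h w v →
        ι d m * h (w ⊕ (- a) · v) (w ⊕ (- a) · v) ≡ (ι d m * h w w - h w v * conj d (h w v)) + ι d m * ι d m * ((t - a) * conj d (t - a))
      completing-square m v w t a h[v,v]≡m m*t≡h[w,v] = begin
        M * h (w ⊕ (- a) · v) (w ⊕ (- a) · v)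
          ≡⟨ cong (M *_) (trans (h-+ˡ w ((- a) · v) _) (cong₂ _+_ (h-+ʳ w w ((- a) · v)) (h-+ʳ ((- a) · v) w ((- a) · v)))) ⟩
        M * ((h w w + h w ((- a) · v)) + (h ((- a) · v) w + h ((- a) · v) ((- a) · v)))
          ≡⟨ cong (M *_) (cong₂ _+_ (cong (_+_ (h w w)) (h-·ʳ w (- a) v))
                                    (cong₂ _+_ (h-·ˡ (- a) v w) (trans (h-·ˡ (- a) v _) (cong (- a *_) (h-·ʳ v (- a) v))))) ⟩
        M * ((h w w + conj d (- a) * h w v) + (- a * h v w + - a * (conj d (- a) * h v v)))
          ≡⟨ cong₂ (λ p q → M * ((h w w + conj d (- a) * p) + (- a * q + - a * (conj d (- a) * h v v)))) (sym m*t≡h[w,v])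
                   (trans (h-swap w v) (trans (cong (conj d) (sym m*t≡h[w,v])) (conj-* M t))) ⟩
        M * ((h w w + conj d (- a) * (M * t)) + (- a * (M * conj d t) + - a * (conj d (- a) * h v v)))
          ≡⟨ cong₂ (λ p q → M * ((h w w + p * (M * t)) + (- a * (M * conj d t) + - a * (p * q)))) (conj-neg a) h[v,v]≡m ⟩
        M * ((h w w + - conj d a * (M * t)) + (- a * (M * conj d t) + - a * (- conj d a * M)))
          ≡⟨ solve 6 (λ M C t t̄ a ā →
               M :* ((C :+ (:- ā) :* (M :* t)) :+ ((:- a) :* (M :* t̄) :+ (:- a) :* ((:- ā) :* M)))
               := (M :* C :- (M :* t) :* (M :* t̄)) :+ M :* M :* ((t :- a) :* (t̄ :- ā)))
             refl M (h w w) t (conj d t) a (conj d a) ⟩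
        (M * h w w - (M * t) * (M * conj d t)) + M * M * ((t - a) * (conj d t - conj d a))
          ≡⟨ cong₂ (λ p q → (M * h w w - p * q) + M * M * ((t - a) * (conj d t - conj d a))) m*t≡h[w,v]
                   (trans (sym (conj-* M t)) (cong (conj d) m*t≡h[w,v])) ⟩
        (M * h w w - h w v * conj d (h w v)) + M * M * ((t - a) * (conj d t - conj d a))
          ≡⟨ cong (λ p → (M * h w w - h w v * conj d (h w v)) + M * M * ((t - a) * p)) (sym (conj-- t a)) ⟩
        (M * h w w - h w v * conj d (h w v)) + M * M * ((t - a) * conj d (t - a))
          ∎
        where
        open ≡-Reasoning
        open K-Solver
        M = ι d m

  module Basis (e₁ e₂ : V d) where

    vec : K → K → V d
    vec x y = x · e₁ ⊕ y · e₂

    vec-+ : ∀ x y x′ y′ → vec (x + x′) (y + y′) ≡ vec x y ⊕ vec x′ y′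
    vec-+ x y x′ y′ = cong₂ _,_ (distribute (proj₁ e₁) (proj₁ e₂)) (distribute (proj₂ e₁) (proj₂ e₂))
      where
      open K-Solver
      distribute : ∀ p r → (x + x′) * p + (y + y′) * r ≡ (x * p + y * r) + (x′ * p + y′ * r)
      distribute = solve 6 (λ x y x′ y′ p r → (x :+ x′) :* p :+ (y :+ y′) :* r := (x :* p :+ y :* r) :+ (x′ :* p :+ y′ :* r)) refl x y x′ y′

    vec-* : ∀ a x y → vec (a * x) (a * y) ≡ a · vec x y
    vec-* a x y = cong₂ _,_ (factor (proj₁ e₁) (proj₁ e₂)) (factor (proj₂ e₁) (proj₂ e₂))
      where
      open K-Solver
      factor : ∀ p r → a * x * p + a * y * r ≡ a * (x * p + y * r)
      factor = solve 5 (λ a x y p r → a :* x :* p :+ a :* y :* r := a :* (x :* p :+ y :* r)) refl a x y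

    vec-0 : vec 0# 0# ≡ 0V d
    vec-0 = cong₂ _,_ (vanish (proj₁ e₁) (proj₁ e₂)) (vanish (proj₂ e₁) (proj₂ e₂))
      where
      open K-Solver
      vanish : ∀ p r → 0# * p + 0# * r ≡ 0#
      vanish = solve 2 (λ p r → con (+ 0) :* p :+ con (+ 0) :* r := con (+ 0)) refl

    -- Cramer's rule: each coordinate times det(e₁, e₂) is a combination of the components of vec x y.
    vec≡0⇒≡0 : 1 ℕ.≤ d → IsBasis d e₁ e₂ → ∀ x y → vec x y ≡ 0V d → x ≡ 0# × y ≡ 0#
    vec≡0⇒≡0 d≥1 det≢0 x y vec≡0 = cancel x*det≡0 , cancel y*det≡0
      where
      open Definite d≥1
      open K-Solver
      p = proj₁ e₁
      q = proj₂ e₁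
      r = proj₁ e₂
      s = proj₂ e₂
      eq₁ : x * p + y * r ≡ 0#
      eq₁ = cong proj₁ vec≡0
      eq₂ : x * q + y * s ≡ 0#
      eq₂ = cong proj₂ vec≡0
      cancel : ∀ {z} → z * (p * s - q * r) ≡ 0# → z ≡ 0#
      cancel {z} z*det≡0 = Sum.[ id , ⊥-elim ∘ det≢0 ]′ (x*y≡0⇒x≡0∨y≡0 z (p * s - q * r) z*det≡0)
      x*det≡0 : x * (p * s - q * r) ≡ 0#
      x*det≡0 = begin
        x * (p * s - q * r)                              ≡⟨ solve 6 (λ x y p q r s → x :* (p :* s :- q :* r) := s :* (x :* p :+ y :* r) :- r :* (x :* q :+ y :* s)) refl x y p q r s ⟩
        s * (x * p + y * r) - r * (x * q + y * s)        ≡⟨ cong₂ (λ u w → s * u - r * w) eq₁ eq₂ ⟩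
        s * 0# - r * 0#                                  ≡⟨ solve 2 (λ s r → s :* con (+ 0) :- r :* con (+ 0) := con (+ 0)) refl s r ⟩
        0#                                               ∎
        where open ≡-Reasoning
      y*det≡0 : y * (p * s - q * r) ≡ 0#
      y*det≡0 = begin
        y * (p * s - q * r)                              ≡⟨ solve 6 (λ x y p q r s → y :* (p :* s :- q :* r) := p :* (x :* q :+ y :* s) :- q :* (x :* p :+ y :* r)) refl x y p q r s ⟩
        p * (x * q + y * s) - q * (x * p + y * r)        ≡⟨ cong₂ (λ u w → p * u - q * w) eq₂ eq₁ ⟩
        p * 0# - q * 0#                                  ≡⟨ solve 2 (λ s r → s :* con (+ 0) :- r :* con (+ 0) := con (+ 0)) refl p q ⟩
        0#                                               ∎
        where open ≡-Reasoning

    module Coordinates (H : Gram d) (H-hermitian : IsHermitian d H) where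
      open Sesquilinear H
      open Hermitian H-hermitian

      gram-det : K
      gram-det = h e₁ e₁ * h e₂ e₂ - h e₁ e₂ * h e₂ e₁

      h-vec : ∀ x y x′ y′ → h (vec x y) (vec x′ y′) ≡
        (x * conj d x′ * h e₁ e₁ + x * conj d y′ * h e₁ e₂) + (y * conj d x′ * h e₂ e₁ + y * conj d y′ * h e₂ e₂)
      h-vec x y x′ y′ = begin
        h (x · e₁ ⊕ y · e₂) w                                              ≡⟨ h-+ˡ (x · e₁) (y · e₂) w ⟩
        h (x · e₁) w + h (y · e₂) w                                        ≡⟨ cong₂ _+_ (h-·ˡ x e₁ w) (h-·ˡ y e₂ w) ⟩
        x * h e₁ w + y * h e₂ w                                            ≡⟨ cong₂ (λ u t → x * u + y * t) (h-+ʳ e₁ (x′ · e₁) (y′ · e₂)) (h-+ʳ e₂ (x′ · e₁) (y′ · e₂)) ⟩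
        x * (h e₁ (x′ · e₁) + h e₁ (y′ · e₂)) + y * (h e₂ (x′ · e₁) + h e₂ (y′ · e₂))
          ≡⟨ cong₂ (λ u t → x * u + y * t) (cong₂ _+_ (h-·ʳ e₁ x′ e₁) (h-·ʳ e₁ y′ e₂)) (cong₂ _+_ (h-·ʳ e₂ x′ e₁) (h-·ʳ e₂ y′ e₂)) ⟩
        x * (conj d x′ * h e₁ e₁ + conj d y′ * h e₁ e₂) + y * (conj d x′ * h e₂ e₁ + conj d y′ * h e₂ e₂)
          ≡⟨ solve 8 (λ x y p q a b c e → x :* (p :* a :+ q :* b) :+ y :* (p :* c :+ q :* e)
                := (x :* p :* a :+ x :* q :* b) :+ (y :* p :* c :+ y :* q :* e))
             refl x y (conj d x′) (conj d y′) (h e₁ e₁) (h e₁ e₂) (h e₂ e₁) (h e₂ e₂) ⟩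
        (x * conj d x′ * h e₁ e₁ + x * conj d y′ * h e₁ e₂) + (y * conj d x′ * h e₂ e₁ + y * conj d y′ * h e₂ e₂)
          ∎
        where
        open ≡-Reasoning
        open K-Solver
        w = vec x′ y′

      gram-det-vec : ∀ x₀ y₀ x₁ y₁ →
        h (vec x₀ y₀) (vec x₀ y₀) * h (vec x₁ y₁) (vec x₁ y₁) - h (vec x₀ y₀) (vec x₁ y₁) * h (vec x₁ y₁) (vec x₀ y₀)
        ≡ gram-det * ((x₀ * y₁ - y₀ * x₁) * conj d (x₀ * y₁ - y₀ * x₁))
      gram-det-vec x₀ y₀ x₁ y₁ = begin
        h (vec x₀ y₀) (vec x₀ y₀) * h (vec x₁ y₁) (vec x₁ y₁) - h (vec x₀ y₀) (vec x₁ y₁) * h (vec x₁ y₁) (vec x₀ y₀)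
          ≡⟨ cong₂ _-_ (cong₂ _*_ (h-vec x₀ y₀ x₀ y₀) (h-vec x₁ y₁ x₁ y₁)) (cong₂ _*_ (h-vec x₀ y₀ x₁ y₁) (h-vec x₁ y₁ x₀ y₀)) ⟩
        E x₀ y₀ (conj d x₀) (conj d y₀) * E x₁ y₁ (conj d x₁) (conj d y₁) - E x₀ y₀ (conj d x₁) (conj d y₁) * E x₁ y₁ (conj d x₀) (conj d y₀)
          ≡⟨ solve 12 (λ x₀ y₀ x₁ y₁ p₀ q₀ p₁ q₁ A B B′ C →
               ((x₀ :* p₀ :* A :+ x₀ :* q₀ :* B) :+ (y₀ :* p₀ :* B′ :+ y₀ :* q₀ :* C))
                 :* ((x₁ :* p₁ :* A :+ x₁ :* q₁ :* B) :+ (y₁ :* p₁ :* B′ :+ y₁ :* q₁ :* C))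
               :- ((x₀ :* p₁ :* A :+ x₀ :* q₁ :* B) :+ (y₀ :* p₁ :* B′ :+ y₀ :* q₁ :* C))
                 :* ((x₁ :* p₀ :* A :+ x₁ :* q₀ :* B) :+ (y₁ :* p₀ :* B′ :+ y₁ :* q₀ :* C))
               := (A :* C :- B :* B′) :* ((x₀ :* y₁ :- y₀ :* x₁) :* (p₀ :* q₁ :- q₀ :* p₁)))
             refl x₀ y₀ x₁ y₁ (conj d x₀) (conj d y₀) (conj d x₁) (conj d y₁) (h e₁ e₁) (h e₁ e₂) (h e₂ e₁) (h e₂ e₂) ⟩
        gram-det * ((x₀ * y₁ - y₀ * x₁) * (conj d x₀ * conj d y₁ - conj d y₀ * conj d x₁))
          ≡⟨ cong (λ z → gram-det * ((x₀ * y₁ - y₀ * x₁) * z)) (sym (trans (conj-- (x₀ * y₁) (y₀ * x₁)) (cong₂ _-_ (conj-* x₀ y₁) (conj-* y₀ x₁)))) ⟩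
        gram-det * ((x₀ * y₁ - y₀ * x₁) * conj d (x₀ * y₁ - y₀ * x₁))
          ∎
        where
        open ≡-Reasoning
        open K-Solver
        E : K → K → K → K → K
        E x y p q = (x * p * h e₁ e₁ + x * q * h e₁ e₂) + (y * p * h e₂ e₁ + y * q * h e₂ e₂)

module Euclidean (d : ℕ) (d≥1 : 1 ℕ.≤ d) (c : ℚ) (c<1 : c ℚ.< 1ℚ)
  (euclidean : ∀ (x : K) → ∃[ a ] (InOK d a × NK d (_-K_ d x a) ℚ.≤ c)) where

  open QuadraticField d
  open Definite d≥1

  x-y≡0⇒x≡y : ∀ x y → x - y ≡ 0# → x ≡ y
  x-y≡0⇒x≡y x y x-y≡0 = begin
    x                 ≡⟨ solve 2 (λ x y → x := (x :- y) :+ y) refl x y ⟩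
    (x - y) + y       ≡⟨ cong (_+ y) x-y≡0 ⟩
    0# + y            ≡⟨ +-identityˡ y ⟩
    y                 ∎
    where
    open ≡-Reasoning
    open K-Solver

  approximation : ∀ ρ → ¬ IntegralTraceNorm ρ → Σ K λ a → InOK d a × ρ - a ≢ 0# × N (ρ - a) ℚ.< 1ℚ
  approximation ρ ρ∉O with euclidean ρ
  ... | a , a∈O , N≤c = a , a∈O , ρ-a≢0 , ℚP.≤-<-trans N≤c c<1
    where
    ρ-a≢0 : ρ - a ≢ 0#
    ρ-a≢0 ρ-a≡0 = ρ∉O (subst IntegralTraceNorm (sym (x-y≡0⇒x≡y ρ a ρ-a≡0)) (integral⇒integralTraceNorm a a∈O))

  module Lattice (H : Gram d) (H-hermitian : IsHermitian d H) (H-posdef : PosDef d H)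
    (k : ℕ) (g : Fin k → V d) (e₁ e₂ : V d) (e-basis : IsBasis d e₁ e₂)
    {j₁ : ℕ} (a₁ : Fin j₁ → K) {j₂ : ℕ} (a₂ : Fin j₂ → K)
    (a₁≢0 : IsFracIdeal d j₁ a₁) (a₂≢0 : IsFracIdeal d j₂ a₂)
    (L≡𝔞₁e₁⊕𝔞₂e₂ : ∀ v → InLat d k g v ⇔ (Σ K λ x → Σ K λ y → (InIdeal d j₁ a₁ x × InIdeal d j₂ a₂ y
                                                              × v ≡ _+V_ d (_·V_ d x e₁) (_·V_ d y e₂))))
    (m : ℚ) (v : V d) (v∈L : InLat d k g v) (v≢0 : v ≢ 0V d) (h[v,v]≡m : qf d H v ≡ m)
    (m-minimal : ∀ w → InLat d k g w → w ≢ 0V d → m ℚ.≤ qf d H w) where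

    open Sesquilinear H
    open Hermitian H-hermitian
    open Basis e₁ e₂
    open Coordinates H H-hermitian
    open Ideal using (ideal-0; ideal-generator; ideal-*; ideal-neg; ideal--; ideal-denominator)

    _∈𝔞₁ _∈𝔞₂ : K → Set
    x ∈𝔞₁ = InIdeal d j₁ a₁ x
    y ∈𝔞₂ = InIdeal d j₂ a₂ y

    v-coordinates = Equivalence.to (L≡𝔞₁e₁⊕𝔞₂e₂ v) v∈L

    x₀ y₀ : K
    x₀ = proj₁ v-coordinates
    y₀ = proj₁ (proj₂ v-coordinates)

    x₀∈𝔞₁ : x₀ ∈𝔞₁
    x₀∈𝔞₁ = proj₁ (proj₂ (proj₂ v-coordinates))

    y₀∈𝔞₂ : y₀ ∈𝔞₂
    y₀∈𝔞₂ = proj₁ (proj₂ (proj₂ (proj₂ v-coordinates)))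

    v≡vec : v ≡ vec x₀ y₀
    v≡vec = proj₂ (proj₂ (proj₂ (proj₂ v-coordinates)))

    0<m : 0ℚ ℚ.< m
    0<m = subst (0ℚ ℚ.<_) h[v,v]≡m (H-posdef v v≢0)

    h[v,v]≡ιm : h v v ≡ ι d m
    h[v,v]≡ιm = trans (h-diag v) (cong (ι d) h[v,v]≡m)

    minimal : ∀ {x y} → x ∈𝔞₁ → y ∈𝔞₂ → vec x y ≢ 0V d → m ℚ.≤ qf d H (vec x y)
    minimal {x} {y} x∈𝔞₁ y∈𝔞₂ = m-minimal (vec x y) (Equivalence.from (L≡𝔞₁e₁⊕𝔞₂e₂ (vec x y)) (x , y , x∈𝔞₁ , y∈𝔞₂ , refl))

    -- Λ x y is the determinant of the coordinates of v and of vec x y; it vanishes iff vec x y is a multiple of v.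
    Λ : K → K → K
    Λ x y = x₀ * y - y₀ * x

    Λ≢0⇒vec≢0 : ∀ x y → Λ x y ≢ 0# → vec x y ≢ 0V d
    Λ≢0⇒vec≢0 x y Λ≢0 vec≡0 = Λ≢0 (trans (cong₂ Λ (proj₁ x,y≡0) (proj₂ x,y≡0)) Λ[0,0]≡0)
      where
      open K-Solver
      x,y≡0 = vec≡0⇒≡0 d≥1 e-basis x y vec≡0
      Λ[0,0]≡0 : Λ 0# 0# ≡ 0#
      Λ[0,0]≡0 = solve 2 (λ a b → a :* con (+ 0) :- b :* con (+ 0) := con (+ 0)) refl x₀ y₀

    Λ-shift : ∀ a x y → Λ (x - a * x₀) (y - a * y₀) ≡ Λ x y
    Λ-shift a x y = solve 5 (λ x₀ y₀ a x y → x₀ :* (y :- a :* y₀) :- y₀ :* (x :- a :* x₀) := x₀ :* y :- y₀ :* x) refl x₀ y₀ a x y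
      where open K-Solver

    vec-shift : ∀ a x y → vec (x - a * x₀) (y - a * y₀) ≡ vec x y ⊕ (- a) · v
    vec-shift a x y = begin
      vec (x - a * x₀) (y - a * y₀)               ≡⟨ cong₂ vec (negate x x₀) (negate y y₀) ⟩
      vec (x + (- a) * x₀) (y + (- a) * y₀)       ≡⟨ vec-+ x y ((- a) * x₀) ((- a) * y₀) ⟩
      vec x y ⊕ vec ((- a) * x₀) ((- a) * y₀)     ≡⟨ cong (vec x y ⊕_) (vec-* (- a) x₀ y₀) ⟩
      vec x y ⊕ (- a) · vec x₀ y₀                 ≡⟨ cong (λ u → vec x y ⊕ (- a) · u) v≡vec ⟨
      vec x y ⊕ (- a) · v                         ∎
      where
      open ≡-Reasoning
      open K-Solver
      negate : ∀ x z → x - a * z ≡ x + (- a) * z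
      negate = solve 3 (λ a x z → x :- a :* z := x :+ (:- a) :* z) refl a

    -- Δ x y is the determinant of the Gram matrix of v and vec x y.
    Δ : K → K → ℚ
    Δ x y = m ℚ.* qf d H (vec x y) ℚ.- N (h (vec x y) v)

    ι-Δ : ∀ x y → ι d (Δ x y) ≡ ι d m * h (vec x y) (vec x y) - h (vec x y) v * conj d (h (vec x y) v)
    ι-Δ x y = begin
      ι d (m ℚ.* qf d H w ℚ.- N (h w v))               ≡⟨ ι-homo-+ (m ℚ.* qf d H w) (ℚ.- N (h w v)) ⟩
      ι d (m ℚ.* qf d H w) - ι d (N (h w v))           ≡⟨ cong₂ _-_ (ι-homo-* m (qf d H w)) (sym (x*conj[x]≡N[x] (h w v))) ⟩
      ι d m * ι d (qf d H w) - h w v * conj d (h w v)  ≡⟨ cong (λ z → ι d m * z - h w v * conj d (h w v)) (sym (h-diag w)) ⟩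
      ι d m * h w w - h w v * conj d (h w v)           ∎
      where
      open ≡-Reasoning
      w = vec x y

    m≢0 : m ≢ 0ℚ
    m≢0 m≡0 = ℚP.<-irrefl (sym m≡0) 0<m

    -- Reduce the coefficient h(w,v)/m of the projection of w = vec x y onto v modulo 𝒪:
    -- the shifted vector w - a v is still in L and nonzero, so its length is at least m.
    euclidean-bound : ∀ {x y} → x ∈𝔞₁ → y ∈𝔞₂ → Λ x y ≢ 0# → m ℚ.* m ℚ.* (1ℚ ℚ.- c) ℚ.≤ Δ x y
    euclidean-bound {x} {y} x∈𝔞₁ y∈𝔞₂ Λ≢0 =
      p≤q+r∧r≤p*s⇒p*[1-s]≤q c m*m≤ (ℚP.*-monoˡ-≤-nonNeg (m ℚ.* m) {{ℚ.nonNegative (0≤p*p m)}} N≤c)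
      where
      w = vec x y
      m⁻¹ = (ℚ.1/ m) {{ℚ.≢-nonZero m≢0}}
      t = h w v * ι d m⁻¹
      a = proj₁ (euclidean t)
      a∈O = proj₁ (proj₂ (euclidean t))
      N≤c : N (t - a) ℚ.≤ c
      N≤c = proj₂ (proj₂ (euclidean t))
      m*t≡h[w,v] : ι d m * t ≡ h w v
      m*t≡h[w,v] = begin
        ι d m * (h w v * ι d m⁻¹)      ≡⟨ solve 3 (λ M b i → M :* (b :* i) := b :* (M :* i)) refl (ι d m) (h w v) (ι d m⁻¹) ⟩
        h w v * (ι d m * ι d m⁻¹)      ≡⟨ cong (h w v *_) (sym (ι-homo-* m m⁻¹)) ⟩
        h w v * ι d (m ℚ.* m⁻¹)        ≡⟨ cong (λ z → h w v * ι d z) (ℚP.*-inverseʳ m {{ℚ.≢-nonZero m≢0}}) ⟩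
        h w v * 1#                     ≡⟨ *-identityʳ (h w v) ⟩
        h w v                          ∎
        where
        open ≡-Reasoning
        open K-Solver
      w′ = vec (x - a * x₀) (y - a * y₀)
      m≤h[w′,w′] : m ℚ.≤ qf d H w′
      m≤h[w′,w′] = minimal (ideal-- a₁ x∈𝔞₁ (ideal-* a₁ a a∈O x₀∈𝔞₁)) (ideal-- a₂ y∈𝔞₂ (ideal-* a₂ a a∈O y₀∈𝔞₂))
        (Λ≢0⇒vec≢0 _ _ (λ Λ′≡0 → Λ≢0 (trans (sym (Λ-shift a x y)) Λ′≡0)))
      m*h[w′,w′]≡ : m ℚ.* qf d H w′ ≡ Δ x y ℚ.+ m ℚ.* m ℚ.* N (t - a)
      m*h[w′,w′]≡ = ι-injective (begin
        ι d (m ℚ.* qf d H w′)                                   ≡⟨ ι-homo-* m (qf d H w′) ⟩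
        ι d m * ι d (qf d H w′)                                 ≡⟨ cong (ι d m *_) (sym (h-diag w′)) ⟩
        ι d m * h w′ w′                                         ≡⟨ cong (λ u → ι d m * h u u) (vec-shift a x y) ⟩
        ι d m * h (w ⊕ (- a) · v) (w ⊕ (- a) · v)               ≡⟨ completing-square m v w t a h[v,v]≡ιm m*t≡h[w,v] ⟩
        (ι d m * h w w - h w v * conj d (h w v)) + ι d m * ι d m * ((t - a) * conj d (t - a))
          ≡⟨ cong₂ _+_ (sym (ι-Δ x y)) (cong₂ _*_ (sym (ι-homo-* m m)) (x*conj[x]≡N[x] (t - a))) ⟩
        ι d (Δ x y) + ι d (m ℚ.* m) * ι d (N (t - a))      ≡⟨ cong (_+_ (ι d (Δ x y))) (sym (ι-homo-* (m ℚ.* m) (N (t - a)))) ⟩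
        ι d (Δ x y) + ι d (m ℚ.* m ℚ.* N (t - a))          ≡⟨ sym (ι-homo-+ (Δ x y) (m ℚ.* m ℚ.* N (t - a))) ⟩
        ι d (Δ x y ℚ.+ m ℚ.* m ℚ.* N (t - a))              ∎)
        where open ≡-Reasoning
      m*m≤ : m ℚ.* m ℚ.≤ Δ x y ℚ.+ m ℚ.* m ℚ.* N (t - a)
      m*m≤ = subst (m ℚ.* m ℚ.≤_) m*h[w′,w′]≡ (ℚP.*-monoˡ-≤-nonNeg m {{ℚ.nonNegative (ℚP.<⇒≤ 0<m)}} m≤h[w′,w′])

    record Pair : Set where
      constructor pair
      field
        {x y} : K
        x∈𝔞₁ : x ∈𝔞₁
        y∈𝔞₂ : y ∈𝔞₂
        Λ≢0 : Λ x y ≢ 0#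

    Λ⟨_⟩ : Pair → K
    Λ⟨ p ⟩ = Λ (Pair.x p) (Pair.y p)

    -- M Λ is integral, where M clears the denominators of both ideals, so N(M Λ) is a natural number.
    M : K
    M = fromℤᴷ (+ (denominatorOfAll j₁ a₁ ℕ.* denominatorOfAll j₂ a₂))

    M≢0 : M ≢ 0#
    M≢0 M≡0 = ℕP.<⇒≢ (ℕP.*-mono-≤ {1} {denominatorOfAll j₁ a₁} (1≤denominatorOfAll j₁ a₁) (1≤denominatorOfAll j₂ a₂))
      (sym (ℤP.+-injective (fromℤ-injective (ι-injective M≡0))))

    integral-MΛ : ∀ {x y} → x ∈𝔞₁ → y ∈𝔞₂ → InOK d (M * Λ x y)
    integral-MΛ {x} {y} x∈𝔞₁ y∈𝔞₂ = subst (InOK d) (sym MΛ≡)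
      (integral-- _ _ (integral-* _ _ (ideal-denominator a₁ x₀∈𝔞₁) (ideal-denominator a₂ y∈𝔞₂))
                      (integral-* _ _ (ideal-denominator a₂ y₀∈𝔞₂) (ideal-denominator a₁ x∈𝔞₁)))
      where
      M₁ = fromℤᴷ (+ denominatorOfAll j₁ a₁)
      M₂ = fromℤᴷ (+ denominatorOfAll j₂ a₂)
      M≡ : M ≡ M₁ * M₂
      M≡ = trans (cong (ι d) (fromℤ-+-* (denominatorOfAll j₁ a₁) (denominatorOfAll j₂ a₂)))
                 (ι-homo-* (fromℤ (+ denominatorOfAll j₁ a₁)) (fromℤ (+ denominatorOfAll j₂ a₂)))
      MΛ≡ : M * Λ x y ≡ (M₁ * x₀) * (M₂ * y) - (M₂ * y₀) * (M₁ * x)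
      MΛ≡ = trans (cong (_* Λ x y) M≡)
        (solve 6 (λ M₁ M₂ x₀ y₀ x y → M₁ :* M₂ :* (x₀ :* y :- y₀ :* x) := (M₁ :* x₀) :* (M₂ :* y) :- (M₂ :* y₀) :* (M₁ :* x)) refl M₁ M₂ x₀ y₀ x y)
        where open K-Solver

    opaque
      measure : ∀ p → Σ ℕ λ n → N (M * Λ⟨ p ⟩) ≡ fromℤ (+ n)
      measure (pair x∈𝔞₁ y∈𝔞₂ _) = integral⇒N≡ℕ _ (integral-MΛ x∈𝔞₁ y∈𝔞₂)

    size : Pair → ℕ
    size p = proj₁ (measure p)

    size≡ : ∀ p → N (M * Λ⟨ p ⟩) ≡ fromℤ (+ size p)
    size≡ p = proj₂ (measure p)

    -- If Λ(x′,y′)/Λ⟨p⟩ is not integral, subtracting its Euclidean approximation a times p gives a pair with smaller Λ.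
    descent : ∀ p {x′ y′} → x′ ∈𝔞₁ → y′ ∈𝔞₂ → ¬ IntegralTraceNorm (Λ x′ y′ * inverse Λ⟨ p ⟩ (Pair.Λ≢0 p)) →
              Σ Pair λ p′ → size p′ ℕ.< size p
    descent p@(pair {x} {y} x∈𝔞₁ y∈𝔞₂ Λ≢0) {x′} {y′} x′∈𝔞₁ y′∈𝔞₂ ρ∉O = p′ , size-p′<size-p
      where
      ρ = Λ x′ y′ * inverse (Λ x y) Λ≢0
      approx = approximation ρ ρ∉O
      a = proj₁ approx
      a∈O = proj₁ (proj₂ approx)
      ρ-a≢0 = proj₁ (proj₂ (proj₂ approx))
      N<1 = proj₂ (proj₂ (proj₂ approx))
      Λ″≡ : Λ (x′ - a * x) (y′ - a * y) ≡ Λ x y * (ρ - a)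
      Λ″≡ = begin
        Λ (x′ - a * x) (y′ - a * y)            ≡⟨ solve 7 (λ x₀ y₀ x′ y′ a x y → x₀ :* (y′ :- a :* y) :- y₀ :* (x′ :- a :* x)
                                                     := (x₀ :* y′ :- y₀ :* x′) :- a :* (x₀ :* y :- y₀ :* x)) refl x₀ y₀ x′ y′ a x y ⟩
        Λ x′ y′ - a * Λ x y                    ≡⟨ cong (_- a * Λ x y) (sym (*-inverse-cancel (Λ x y) Λ≢0 (Λ x′ y′))) ⟩
        Λ x y * ρ - a * Λ x y                  ≡⟨ solve 3 (λ l r a → l :* r :- a :* l := l :* (r :- a)) refl (Λ x y) ρ a ⟩
        Λ x y * (ρ - a)                        ∎
        where
        open ≡-Reasoning
        open K-Solver
      p′ = pair (ideal-- a₁ x′∈𝔞₁ (ideal-* a₁ a a∈O x∈𝔞₁)) (ideal-- a₂ y′∈𝔞₂ (ideal-* a₂ a a∈O y∈𝔞₂))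
        (subst (_≢ 0#) (sym Λ″≡) (x≢0∧y≢0⇒x*y≢0 Λ≢0 ρ-a≢0))
      size-p′<size-p : size p′ ℕ.< size p
      size-p′<size-p = ℤP.drop‿+<+ (fromℤ-cancel-< (subst₂ ℚ._<_ (size≡ p′) (size≡ p) (begin-strict
        N (M * Λ⟨ p′ ⟩)                        ≡⟨ cong (N ∘ (M *_)) Λ″≡ ⟩
        N (M * (Λ x y * (ρ - a)))              ≡⟨ cong N (sym (*-assoc M (Λ x y) (ρ - a))) ⟩
        N (M * Λ x y * (ρ - a))                ≡⟨ N-homo-* (M * Λ x y) (ρ - a) ⟩
        N (M * Λ x y) ℚ.* N (ρ - a)            <⟨ p*q<p 0<N[MΛ] N<1 ⟩
        N (M * Λ x y)                          ∎)))
        where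
        open ℚP.≤-Reasoning
        0<N[MΛ] : 0ℚ ℚ.< N (M * Λ x y)
        0<N[MΛ] = 0≤p∧p≢0⇒0<p (0≤N (M * Λ x y)) (N≢0 (x≢0∧y≢0⇒x*y≢0 M≢0 Λ≢0))

    Λ⁻¹ : Pair → K
    Λ⁻¹ p = inverse Λ⟨ p ⟩ (Pair.Λ≢0 p)

    Λ[0,a₂]≡ : ∀ l → Λ 0# (a₂ l) ≡ x₀ * a₂ l
    Λ[0,a₂]≡ l = solve 3 (λ x₀ y₀ a → x₀ :* a :- y₀ :* con (+ 0) := x₀ :* a) refl x₀ y₀ (a₂ l)
      where open K-Solver

    Λ[-a₁,0]≡ : ∀ i → Λ (- a₁ i) 0# ≡ y₀ * a₁ i
    Λ[-a₁,0]≡ i = solve 3 (λ x₀ y₀ a → x₀ :* con (+ 0) :- y₀ :* (:- a) := y₀ :* a) refl x₀ y₀ (a₁ i)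
      where open K-Solver

    -- Λ⟨p⟩ divides x₀𝔞₂ and y₀𝔞₁ (the values of Λ on 0 × 𝔞₂ and 𝔞₁ × 0).
    Saturated : Pair → Set
    Saturated p = (∀ l → IntegralTraceNorm (Λ 0# (a₂ l) * Λ⁻¹ p)) × (∀ i → IntegralTraceNorm (Λ (- a₁ i) 0# * Λ⁻¹ p))

    opaque
      saturate : Pair → Σ Pair Saturated
      saturate = All.wfRec (On.wellFounded size <-wellFounded) 0ℓ (λ _ → Σ Pair Saturated) step
        where
        step : ∀ p → (∀ {p′} → size p′ ℕ.< size p → Σ Pair Saturated) → Σ Pair Saturated
        step p recurse = check (toSum (FinP.all? A?)) (toSum (FinP.all? B?))
          where
          A : Fin j₂ → Set
          A l = IntegralTraceNorm (Λ 0# (a₂ l) * Λ⁻¹ p)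
          A? : ∀ l → Dec (A l)
          A? l = integralTraceNorm? (Λ 0# (a₂ l) * Λ⁻¹ p)
          B : Fin j₁ → Set
          B i = IntegralTraceNorm (Λ (- a₁ i) 0# * Λ⁻¹ p)
          B? : ∀ i → Dec (B i)
          B? i = integralTraceNorm? (Λ (- a₁ i) 0# * Λ⁻¹ p)
          continue : Σ Pair (λ p′ → size p′ ℕ.< size p) → Σ Pair Saturated
          continue (p′ , smaller) = recurse smaller
          check : (∀ l → A l) ⊎ ¬ (∀ l → A l) → (∀ i → B i) ⊎ ¬ (∀ i → B i) → Σ Pair Saturated
          check (inj₁ all-A) (inj₁ all-B) = p , all-A , all-B
          check (inj₂ ¬all-A) _ = continue (descent p (ideal-0 a₁) (ideal-generator a₂ (proj₁ l)) (proj₂ l))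
            where
            l : Σ (Fin j₂) (λ l → ¬ A l)
            l = FinP.¬∀⟶∃¬ j₂ A A? ¬all-A
          check _ (inj₂ ¬all-B) = continue (descent p (ideal-neg a₁ (ideal-generator a₁ (proj₁ i))) (ideal-0 a₂) (proj₂ i))
            where
            i : Σ (Fin j₁) (λ i → ¬ B i)
            i = FinP.¬∀⟶∃¬ j₁ B B? ¬all-B

    initial : Pair
    initial = start (x₀ ≟ 0#)
      where
      start : Dec (x₀ ≡ 0#) → Pair
      start (no x₀≢0) = pair (ideal-0 a₁) (ideal-generator a₂ l) Λ≢0
        where
        l = proj₁ a₂≢0
        Λ≢0 = subst (_≢ 0#) (sym (Λ[0,a₂]≡ l)) (x≢0∧y≢0⇒x*y≢0 x₀≢0 (proj₂ a₂≢0))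
      start (yes x₀≡0) = pair (ideal-neg a₁ (ideal-generator a₁ i)) (ideal-0 a₂) Λ≢0
        where
        i = proj₁ a₁≢0
        y₀≢0 : y₀ ≢ 0#
        y₀≢0 y₀≡0 = v≢0 (trans v≡vec (trans (cong₂ vec x₀≡0 y₀≡0) vec-0))
        Λ≢0 = subst (_≢ 0#) (sym (Λ[-a₁,0]≡ i)) (x≢0∧y≢0⇒x*y≢0 y₀≢0 (proj₂ a₁≢0))

    p₁ : Pair
    p₁ = proj₁ (saturate initial)

    x₁ y₁ λ₁ λ₁⁻¹ : K
    x₁ = Pair.x p₁
    y₁ = Pair.y p₁
    λ₁ = Λ⟨ p₁ ⟩
    λ₁⁻¹ = Λ⁻¹ p₁

    ρ : Fin j₁ → Fin j₂ → K
    ρ i l = a₁ i * a₂ l * λ₁⁻¹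

    -- If ρ i l were not integral, then for its approximation a the vector (ρ i l - a) v
    -- would be a nonzero vector of L shorter than v.
    integral-ρ : ∀ i l → InOK d (ρ i l)
    integral-ρ i l = integralTraceNorm⇒integral (ρ i l) (decidable-stable (integralTraceNorm? (ρ i l)) ¬ρ∉O)
      where
      ¬ρ∉O : ¬ ¬ IntegralTraceNorm (ρ i l)
      ¬ρ∉O ρ∉O = ℚP.<-irrefl refl (ℚP.≤-<-trans m≤qf[u] (subst (ℚ._< m) (sym qf[u]≡) (p*q<p 0<m N<1)))
        where
        approx = approximation (ρ i l) ρ∉O
        a = proj₁ approx
        a∈O = proj₁ (proj₂ approx)
        ρ-a≢0 = proj₁ (proj₂ (proj₂ approx))
        N<1 = proj₂ (proj₂ (proj₂ approx))
        κₗ = Λ 0# (a₂ l) * λ₁⁻¹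
        κᵢ = Λ (- a₁ i) 0# * λ₁⁻¹
        κₗa₁≡ρx₀ : κₗ * a₁ i ≡ ρ i l * x₀
        κₗa₁≡ρx₀ = trans (cong (λ z → z * λ₁⁻¹ * a₁ i) (Λ[0,a₂]≡ l))
          (solve 4 (λ x a b i → x :* b :* i :* a := a :* b :* i :* x) refl x₀ (a₁ i) (a₂ l) λ₁⁻¹)
          where open K-Solver
        κᵢa₂≡ρy₀ : κᵢ * a₂ l ≡ ρ i l * y₀
        κᵢa₂≡ρy₀ = trans (cong (λ z → z * λ₁⁻¹ * a₂ l) (Λ[-a₁,0]≡ i))
          (solve 4 (λ y a b i → y :* a :* i :* b := a :* b :* i :* y) refl y₀ (a₁ i) (a₂ l) λ₁⁻¹)
          where open K-Solver
        X = κₗ * a₁ i - a * x₀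
        Y = κᵢ * a₂ l - a * y₀
        factor : ∀ z w → z ≡ ρ i l * w → z - a * w ≡ (ρ i l - a) * w
        factor z w z≡ρw = trans (cong (_- a * w) z≡ρw) (solve 3 (λ r a w → r :* w :- a :* w := (r :- a) :* w) refl (ρ i l) a w)
          where open K-Solver
        X≡ = factor _ x₀ κₗa₁≡ρx₀
        Y≡ = factor _ y₀ κᵢa₂≡ρy₀
        u = vec X Y
        u≡ : u ≡ (ρ i l - a) · v
        u≡ = trans (cong₂ vec X≡ Y≡) (trans (vec-* (ρ i l - a) x₀ y₀) (cong ((ρ i l - a) ·_) (sym v≡vec)))
        u≢0 : u ≢ 0V d
        u≢0 u≡0 = v≢0 (trans v≡vec (trans (cong₂ vec (cancel x₀ X≡ (proj₁ X,Y≡0)) (cancel y₀ Y≡ (proj₂ X,Y≡0))) vec-0))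
          where
          X,Y≡0 = vec≡0⇒≡0 d≥1 e-basis X Y u≡0
          cancel : ∀ w {z} → z ≡ (ρ i l - a) * w → z ≡ 0# → w ≡ 0#
          cancel w z≡ z≡0 = Sum.[ ⊥-elim ∘ ρ-a≢0 , id ]′ (x*y≡0⇒x≡0∨y≡0 (ρ i l - a) w (trans (sym z≡) z≡0))
        m≤qf[u] : m ℚ.≤ qf d H u
        m≤qf[u] = minimal (ideal-- a₁ (ideal-* a₁ κₗ (integralTraceNorm⇒integral κₗ (proj₁ (proj₂ (saturate initial)) l)) (ideal-generator a₁ i))
                                      (ideal-* a₁ a a∈O x₀∈𝔞₁))
                          (ideal-- a₂ (ideal-* a₂ κᵢ (integralTraceNorm⇒integral κᵢ (proj₂ (proj₂ (saturate initial)) i)) (ideal-generator a₂ l))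
                                      (ideal-* a₂ a a∈O y₀∈𝔞₂))
                          u≢0
        qf[u]≡ : qf d H u ≡ m ℚ.* N (ρ i l - a)
        qf[u]≡ = ι-injective (begin
          ι d (qf d H u)                          ≡⟨ h-diag u ⟨
          h u u                                   ≡⟨ cong (λ z → h z z) u≡ ⟩
          h ((ρ i l - a) · v) ((ρ i l - a) · v)   ≡⟨ h-scale (ρ i l - a) v ⟩
          ι d (N (ρ i l - a)) * h v v             ≡⟨ cong (ι d (N (ρ i l - a)) *_) h[v,v]≡ιm ⟩
          ι d (N (ρ i l - a)) * ι d m             ≡⟨ ι-homo-* (N (ρ i l - a)) m ⟨
          ι d (N (ρ i l - a) ℚ.* m)               ≡⟨ cong (ι d) (ℚP.*-comm (N (ρ i l - a)) m) ⟩
          ι d (m ℚ.* N (ρ i l - a))               ∎)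
          where open ≡-Reasoning

    gram-det*N[λ₁]≡Δ : gram-det * ι d (N λ₁) ≡ ι d (Δ x₁ y₁)
    gram-det*N[λ₁]≡Δ = begin
      gram-det * ι d (N λ₁)                                     ≡⟨ cong (gram-det *_) (x*conj[x]≡N[x] λ₁) ⟨
      gram-det * (λ₁ * conj d λ₁)                               ≡⟨ gram-det-vec x₀ y₀ x₁ y₁ ⟨
      h (vec x₀ y₀) (vec x₀ y₀) * h w w - h (vec x₀ y₀) w * h w (vec x₀ y₀)
                                                                ≡⟨ cong (λ z → h z z * h w w - h z w * h w z) v≡vec ⟨
      h v v * h w w - h v w * h w v                             ≡⟨ cong₂ (λ p q → p * h w w - q * h w v) h[v,v]≡ιm (h-swap w v) ⟩
      ι d m * h w w - conj d (h w v) * h w v                    ≡⟨ cong (λ z → ι d m * h w w - z) (*-comm (conj d (h w v)) (h w v)) ⟩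
      ι d m * h w w - h w v * conj d (h w v)                    ≡⟨ ι-Δ x₁ y₁ ⟨
      ι d (Δ x₁ y₁)                                             ∎
      where
      open ≡-Reasoning
      w = vec x₁ y₁

    generators≡ : ∀ i i′ l l′ → (a₁ i * conj d (a₁ i′)) * (a₂ l * conj d (a₂ l′)) ≡ ι d (N λ₁) * (ρ i l * conj d (ρ i′ l′))
    generators≡ i i′ l l′ = begin
      (a₁ i * conj d (a₁ i′)) * (a₂ l * conj d (a₂ l′))         ≡⟨ interchange (a₁ i) (conj d (a₁ i′)) (a₂ l) (conj d (a₂ l′)) ⟩
      (a₁ i * a₂ l) * (conj d (a₁ i′) * conj d (a₂ l′))         ≡⟨ cong ((a₁ i * a₂ l) *_) (conj-* (a₁ i′) (a₂ l′)) ⟨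
      (a₁ i * a₂ l) * conj d (a₁ i′ * a₂ l′)                    ≡⟨ cong₂ (λ p q → p * conj d q) (λ₁*ρ≡ i l) (λ₁*ρ≡ i′ l′) ⟨
      (λ₁ * ρ i l) * conj d (λ₁ * ρ i′ l′)                      ≡⟨ cong ((λ₁ * ρ i l) *_) (conj-* λ₁ (ρ i′ l′)) ⟩
      (λ₁ * ρ i l) * (conj d λ₁ * conj d (ρ i′ l′))             ≡⟨ interchange λ₁ (ρ i l) (conj d λ₁) (conj d (ρ i′ l′)) ⟩
      (λ₁ * conj d λ₁) * (ρ i l * conj d (ρ i′ l′))             ≡⟨ cong (_* (ρ i l * conj d (ρ i′ l′))) (x*conj[x]≡N[x] λ₁) ⟩
      ι d (N λ₁) * (ρ i l * conj d (ρ i′ l′))                   ∎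
      where
      open ≡-Reasoning
      λ₁*ρ≡ : ∀ i l → λ₁ * ρ i l ≡ a₁ i * a₂ l
      λ₁*ρ≡ i l = *-inverse-cancel λ₁ (Pair.Λ≢0 p₁) (a₁ i * a₂ l)

    -- Each generator of the discriminant ideal is gram-det · N(λ₁) · ρ ρ̄′, so d_L is an integral multiple of Δ x₁ y₁.
    Δ≤discriminant : ∀ dL → 0ℚ ℚ.< dL →
      (∀ z → InDiscIdeal d gram-det j₁ a₁ j₂ a₂ z ⇔ (Σ K λ γ → (InOK d γ × z ≡ ι d dL * γ))) →
      Δ x₁ y₁ ℚ.≤ dL
    Δ≤discriminant dL 0<dL disc≡dL = integral-multiple⇒≤ μ 0<dL 0<Δ μ∈O ιdL≡Δ*μ
      where
      Γ-data = Equivalence.from (disc≡dL (ι d dL)) (1# , integral-1 , sym (*-identityʳ (ι d dL)))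
      Γ = proj₁ Γ-data
      Γ∈O = proj₁ (proj₂ Γ-data)
      ∑⁴ : (Fin j₁ → Fin j₁ → Fin j₂ → Fin j₂ → K) → K
      ∑⁴ f = ∑ j₁ (λ i → ∑ j₁ (λ i′ → ∑ j₂ (λ l → ∑ j₂ (λ l′ → f i i′ l l′))))
      μ = ∑⁴ (λ i i′ l l′ → Γ i i′ l l′ * (ρ i l * conj d (ρ i′ l′)))
      μ∈O : InOK d μ
      μ∈O = integral-∑ j₁ _ (λ i → integral-∑ j₁ _ (λ i′ → integral-∑ j₂ _ (λ l → integral-∑ j₂ _ (λ l′ →
              integral-* _ _ (Γ∈O i i′ l l′) (integral-* _ _ (integral-ρ i l) (integral-conj _ (integral-ρ i′ l′)))))))
      D = gram-det * ι d (N λ₁)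
      pull : ∀ {n} (f g : Fin n → K) → (∀ i → f i ≡ D * g i) → ∑ n f ≡ D * ∑ n g
      pull {n} f g f≡Dg = trans (∑-cong n f≡Dg) (sym (*-distribˡ-∑ n D g))
      term : ∀ i i′ l l′ → Γ i i′ l l′ * (gram-det * ((a₁ i * conj d (a₁ i′)) * (a₂ l * conj d (a₂ l′))))
                           ≡ D * (Γ i i′ l l′ * (ρ i l * conj d (ρ i′ l′)))
      term i i′ l l′ = trans (cong (λ z → Γ i i′ l l′ * (gram-det * z)) (generators≡ i i′ l l′))
        (solve 4 (λ γ g n r → γ :* (g :* (n :* r)) := (g :* n) :* (γ :* r)) refl (Γ i i′ l l′) gram-det (ι d (N λ₁)) (ρ i l * conj d (ρ i′ l′)))
        where open K-Solver
      ιdL≡Δ*μ : ι d dL ≡ ι d (Δ x₁ y₁) * μ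
      ιdL≡Δ*μ = trans (proj₂ (proj₂ Γ-data)) (trans
        (pull _ _ (λ i → pull _ _ (λ i′ → pull _ _ (λ l → pull _ _ (λ l′ → term i i′ l l′)))))
        (cong (_* μ) gram-det*N[λ₁]≡Δ))
      0<Δ : 0ℚ ℚ.< Δ x₁ y₁
      0<Δ = ℚP.<-≤-trans (0<p*q (0<p*q 0<m 0<m) 0<1-c) (euclidean-bound (Pair.x∈𝔞₁ p₁) (Pair.y∈𝔞₂ p₁) (Pair.Λ≢0 p₁))
        where
        0<1-c : 0ℚ ℚ.< 1ℚ ℚ.- c
        0<1-c = subst (ℚ._< 1ℚ ℚ.- c) (ℚP.+-inverseʳ c) (ℚP.+-monoˡ-< (ℚ.- c) c<1)

    discriminant-bound : ∀ dL → 0ℚ ℚ.< dL →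
      (∀ z → InDiscIdeal d gram-det j₁ a₁ j₂ a₂ z ⇔ (Σ K λ γ → (InOK d γ × z ≡ ι d dL * γ))) →
      m ℚ.* m ℚ.* (1ℚ ℚ.- c) ℚ.≤ dL
    discriminant-bound dL 0<dL disc≡dL = ℚP.≤-trans (euclidean-bound (Pair.x∈𝔞₁ p₁) (Pair.y∈𝔞₂ p₁) (Pair.Λ≢0 p₁))
      (Δ≤discriminant dL 0<dL disc≡dL)

proposition3p5 : (d : ℕ) → 1 ℕ.≤ d → SquareFree d →
    (c : ℚ) → c ℚ.< 1ℚ →
    (∀ (x : K) → ∃[ a ] (InOK d a × NK d (_-K_ d x a) ℚ.≤ c)) →
    (H : Gram d) → IsHermitian d H → PosDef d H →
    (k : ℕ) (g : Fin k → V d) → ContainsBasis d k g →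
    (m : ℚ) → IsMinimum d H k g m →
    (dL : ℚ) → IsDiscriminant d H k g dL →
    (m ℚ.* m) ℚ.* (1ℚ ℚ.- c) ℚ.≤ dL
proposition3p5 d d≥1 _ c c<1 euclidean H H-hermitian H-posdef k g _ m ((v , v∈L , v≢0 , h[v,v]≡m) , m-minimal) dL
  (e₁ , e₂ , j₁ , a₁ , j₂ , a₂ , e-basis , a₁≢0 , a₂≢0 , L≡𝔞₁e₁⊕𝔞₂e₂ , 0<dL , disc≡dL) =
  Lattice.discriminant-bound H H-hermitian H-posdef k g e₁ e₂ e-basis a₁ a₂ a₁≢0 a₂≢0 L≡𝔞₁e₁⊕𝔞₂e₂
    m v v∈L v≢0 h[v,v]≡m m-minimal dL 0<dL disc≡dL
  where open Euclidean d d≥1 c c<1 euclidean
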